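{- Let $n,k$ be positive integers with $k\le n-1$, let $a_0,\dots,a_k$ be nonzero integers each of whose prime factors is $\le k$, and let \[ f(x)=\sum_{j=0}^{k} a_j c_j x^j,\qquad c_j=\binom{n}{j}\binom{n-j-1}{k-j}(-1)^{k-j}. \] Let $p$ be a prime with $p>k$ and $e$ a positive integer such that $\nu_p(n)=e$ or $\nu_p(n-k)=e$. Then every nonconstant irreducible factor of $f(x)$ in $\mathbb{Q}[x]$ has degree a multiple of $k/\gcd(k,e)$.
   Context: For a prime $p$ and nonzero integer $m$, $\nu_p(m)$ denotes the exponent $r$ with $p^r\mid m$, $p^{r+1}\nmid m$. -}

module Defs where

open import Data.Nat as ℕ using (ℕ; zero; suc; _<_; _≤_; _^_)
open import Data.Nat.Divisibility using (_∣_; quotient)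
open import Data.Nat.GCD using (gcd; gcd[m,n]∣m)
open import Data.Nat.Combinatorics using (_C_)
open import Data.Integer as ℤ using (ℤ; +_; -[1+_])
open import Data.Rational as ℚ using (ℚ; 0ℚ)
open import Data.List using (List; []; _∷_; map; upTo)
open import Data.Product using (_×_; ∃)
open import Data.Sum using (_⊎_)
open import Relation.Nullary using (¬_)
open import Relation.Binary.PropositionalEquality using (_≡_; _≢_)

ValEq : ℕ → ℕ → ℕ → Set
ValEq p m e = (p ^ e ∣ m) × ¬ (p ^ suc e ∣ m)

kOverGcd : ℕ → ℕ → ℕ
kOverGcd k e = quotient (gcd[m,n]∣m k e)

-- Polynomials over ℚ: coefficient lists, lowest degree first
Poly : Set
Poly = List ℚ

coeff : Poly → ℕ → ℚ
coeff []      _       = 0ℚ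
coeff (a ∷ p) zero    = a
coeff (a ∷ p) (suc i) = coeff p i

_+ₚ_ : Poly → Poly → Poly
[]      +ₚ q       = q
(a ∷ p) +ₚ []      = a ∷ p
(a ∷ p) +ₚ (b ∷ q) = (a ℚ.+ b) ∷ (p +ₚ q)

scaleₚ : ℚ → Poly → Poly
scaleₚ c = map (c ℚ.*_)

_*ₚ_ : Poly → Poly → Poly
[]      *ₚ q = []
(a ∷ p) *ₚ q = scaleₚ a q +ₚ (0ℚ ∷ (p *ₚ q))

-- equality of polynomials (coefficientwise, so trailing zeros are irrelevant)
_≈ₚ_ : Poly → Poly → Set
p ≈ₚ q = ∀ i → coeff p i ≡ coeff q i

HasDegree : Poly → ℕ → Set
HasDegree p d = (coeff p d ≢ 0ℚ) × (∀ i → d < i → coeff p i ≡ 0ℚ)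

IsConstant : Poly → Set
IsConstant p = ∀ i → 1 ≤ i → coeff p i ≡ 0ℚ

_∣ₚ_ : Poly → Poly → Set
g ∣ₚ f = ∃ λ h → (g *ₚ h) ≈ₚ f

-- irreducible in ℚ[x]: nonconstant, and any factorization has a constant
-- (necessarily nonzero, hence unit) factor
Irreducible : Poly → Set
Irreducible g = (∃ λ d → HasDegree g d × 1 ≤ d)
              × (∀ u v → (u *ₚ v) ≈ₚ g → IsConstant u ⊎ IsConstant v)

signPow : ℕ → ℤ
signPow zero    = + 1
signPow (suc m) = ℤ.- signPow m

cCoef : ℕ → ℕ → ℕ → ℤ
cCoef n k j = + ((n C j) ℕ.* ((n ℕ.∸ j ℕ.∸ 1) C (k ℕ.∸ j))) ℤ.* signPow (k ℕ.∸ j)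

fPoly : ℕ → ℕ → (ℕ → ℤ) → Poly
fPoly n k a = map (λ j → ((a j ℤ.* cCoef n k j) ℚ./ 1)) (upTo (suc k))

-- Write ν for the p-adic valuation and weigh a coefficient x in degree i by W(x, i) = k·ν(x) + s·i,
-- with s = ∓e.  The binomial factors of c_j make every coefficient of f weigh at least as much as
-- the coefficients in degrees 0 and k, which weigh the same: the Newton polygon of f is one edge
-- of slope ±e/k.  Clearing denominators in f = g·h, the extreme terms of minimal weight of the
-- integer coefficient sequences G and H multiply to a term of G ⋆ H that cannot cancel (Dumas), so
-- G attains its minimal weight both at 0 and at d = deg g.  Then k·ν(G₀) = k·ν(G_d) ± e·d, so
-- k ∣ e·d and k / gcd(k, e) ∣ d.
module Submission where

open import Defs
open import Data.Nat as ℕ using (ℕ; zero; suc; _<_; _≤_; _∸_; _^_; _⊓_; _!; _/_; z≤n; s≤s)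
open import Data.Nat.DivMod using (m/n*n≡m)
open import Data.Nat.GCD using (gcd; gcd[m,n]∣m; gcd[m,n]∣n; gcd[m,n]≢0)
open import Data.Nat.Coprimality using (Coprime; coprime-/gcd; coprime-divisor)
open import Data.Nat.Combinatorics using (_C_; _P_; nCk≡nPk/k!; nPk≡n!/[n∸k]!)
open import Data.Nat.Combinatorics.Base using (_P′_)
open import Data.Nat.Combinatorics.Specification using (nP′k≡n!/[n∸k]!; k!∣nP′k)
open import Data.Nat.Divisibility as ℕD using (_∣_; divides; n∣m*n; _∣0)
open import Data.Nat.Primality using (Prime; prime⇒nonZero; prime⇒nonTrivial; euclidsLemma)
import Data.Nat.Properties as ℕP
open import Data.Integer as ℤ using (ℤ; +_; 0ℤ; ∣_∣; _⊖_)
import Data.Integer.Divisibility.Signed as ℤD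
import Data.Integer.Properties as ℤP
open import Data.Rational as ℚ using (ℚ; 0ℚ; mkℚ; ↥_; ↧ₙ_)
import Data.Rational.Properties as ℚP
import Data.Rational.Unnormalised as ℚᵘ
import Data.Rational.Unnormalised.Properties as ℚᵘP
open import Data.List using ([]; _∷_; map; applyUpTo; length)
open import Data.Product using (_×_; _,_; proj₁; proj₂; ∃; ∃₂)
open import Data.Sum using (_⊎_; inj₁; inj₂; [_,_]′)
open import Data.Empty using (⊥-elim)
open import Function using (_∘_; id)
open import Algebra.Bundles using (CommutativeMonoid)
import Algebra.Properties.CommutativeSemigroup as CommutativeSemigroupProperties
open import Relation.Binary.PropositionalEquality
open import Relation.Binary.Definitions using (tri<; tri≈; tri>)
open import Relation.Nullary using (¬_; ¬?; yes; no; _×-dec_)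
open import Relation.Nullary.Decidable using (decidable-stable)
open import Relation.Unary using (Decidable)
open import Induction.WellFounded using (Acc; acc)
open import Data.Nat.Induction using (<-wellFounded)

module ℕ* = CommutativeSemigroupProperties ℕP.*-commutativeSemigroup
module ℤ+ = CommutativeSemigroupProperties ℤP.+-commutativeSemigroup
module ℚ* = CommutativeSemigroupProperties
  (CommutativeMonoid.commutativeSemigroup ℚP.*-1-commutativeMonoid)

∑≤ : {A : Set} → (A → A → A) → ℕ → (ℕ → A) → A
∑≤ _⊕_ zero    t = t 0
∑≤ _⊕_ (suc r) t = t 0 ⊕ ∑≤ _⊕_ r (t ∘ suc)

module _ {A : Set} {_⊕_ : A → A → A} where

  ∑≤-cong : ∀ r {t u : ℕ → A} → (∀ i → t i ≡ u i) → ∑≤ _⊕_ r t ≡ ∑≤ _⊕_ r u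
  ∑≤-cong zero    t≗u = t≗u 0
  ∑≤-cong (suc r) t≗u = cong₂ _⊕_ (t≗u 0) (∑≤-cong r (t≗u ∘ suc))

  ∑≤-homo : {B : Set} {_⊞_ : B → B → B} (φ : A → B) → (∀ x y → φ (x ⊕ y) ≡ φ x ⊞ φ y) →
            ∀ r t → φ (∑≤ _⊕_ r t) ≡ ∑≤ _⊞_ r (φ ∘ t)
  ∑≤-homo φ homo zero    t = refl
  ∑≤-homo {_⊞_ = _⊞_} φ homo (suc r) t =
    trans (homo (t 0) _) (cong (φ (t 0) ⊞_) (∑≤-homo φ homo r (t ∘ suc)))

toℚ : ℤ → ℚ
toℚ x = x ℚ./ 1

fromℚᵘ-homo-+ : ∀ u v → ℚ.fromℚᵘ (u ℚᵘ.+ v) ≡ ℚ.fromℚᵘ u ℚ.+ ℚ.fromℚᵘ v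
fromℚᵘ-homo-+ u v = ℚP.toℚᵘ-injective (ℚᵘP.≃-trans (ℚP.toℚᵘ-fromℚᵘ _) (ℚᵘP.≃-sym
  (ℚᵘP.≃-trans (ℚP.toℚᵘ-homo-+ (ℚ.fromℚᵘ u) _) (ℚᵘP.+-cong (ℚP.toℚᵘ-fromℚᵘ u) (ℚP.toℚᵘ-fromℚᵘ v)))))

fromℚᵘ-homo-* : ∀ u v → ℚ.fromℚᵘ (u ℚᵘ.* v) ≡ ℚ.fromℚᵘ u ℚ.* ℚ.fromℚᵘ v
fromℚᵘ-homo-* u v = ℚP.toℚᵘ-injective (ℚᵘP.≃-trans (ℚP.toℚᵘ-fromℚᵘ _) (ℚᵘP.≃-sym
  (ℚᵘP.≃-trans (ℚP.toℚᵘ-homo-* (ℚ.fromℚᵘ u) _) (ℚᵘP.*-cong (ℚP.toℚᵘ-fromℚᵘ u) (ℚP.toℚᵘ-fromℚᵘ v)))))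

toℚ-+ : ∀ x y → toℚ (x ℤ.+ y) ≡ toℚ x ℚ.+ toℚ y
toℚ-+ x y = trans (ℚP.fromℚᵘ-cong {ℚᵘ.mkℚᵘ (x ℤ.+ y) 0} {ℚᵘ.mkℚᵘ x 0 ℚᵘ.+ ℚᵘ.mkℚᵘ y 0}
                                   (ℚᵘ.*≡* (cong (ℤ._* + 1) x+y≡x*1+y*1)))
                  (fromℚᵘ-homo-+ (ℚᵘ.mkℚᵘ x 0) (ℚᵘ.mkℚᵘ y 0))
  where
  x+y≡x*1+y*1 : x ℤ.+ y ≡ x ℤ.* + 1 ℤ.+ y ℤ.* + 1
  x+y≡x*1+y*1 = sym (cong₂ ℤ._+_ (ℤP.*-identityʳ x) (ℤP.*-identityʳ y))

toℚ-* : ∀ x y → toℚ (x ℤ.* y) ≡ toℚ x ℚ.* toℚ y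
toℚ-* x y = fromℚᵘ-homo-* (ℚᵘ.mkℚᵘ x 0) (ℚᵘ.mkℚᵘ y 0)

toℚ-injective : ∀ {x y} → toℚ x ≡ toℚ y → x ≡ y
toℚ-injective {x} {y} eq with ℚP.fromℚᵘ-injective {ℚᵘ.mkℚᵘ x 0} {ℚᵘ.mkℚᵘ y 0} eq
... | ℚᵘ.*≡* x*1≡y*1 = trans (sym (ℤP.*-identityʳ x)) (trans x*1≡y*1 (ℤP.*-identityʳ y))

coeff-+ₚ : ∀ f g i → coeff (f +ₚ g) i ≡ coeff f i ℚ.+ coeff g i
coeff-+ₚ []      g       i       = sym (ℚP.+-identityˡ (coeff g i))
coeff-+ₚ (a ∷ f) []      i       = sym (ℚP.+-identityʳ (coeff (a ∷ f) i))
coeff-+ₚ (a ∷ f) (b ∷ g) zero    = refl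
coeff-+ₚ (a ∷ f) (b ∷ g) (suc i) = coeff-+ₚ f g i

coeff-scaleₚ : ∀ c f i → coeff (scaleₚ c f) i ≡ c ℚ.* coeff f i
coeff-scaleₚ c []      i       = sym (ℚP.*-zeroʳ c)
coeff-scaleₚ c (a ∷ f) zero    = refl
coeff-scaleₚ c (a ∷ f) (suc i) = coeff-scaleₚ c f i

coeff-*ₚ : ∀ f g r → coeff (f *ₚ g) r ≡ ∑≤ ℚ._+_ r (λ i → coeff f i ℚ.* coeff g (r ∸ i))
coeff-*ₚ []      g r       = sym (∑≤-zero r (λ i → coeff g (r ∸ i)))
  where
  ∑≤-zero : ∀ r (t : ℕ → ℚ) → ∑≤ ℚ._+_ r (λ i → 0ℚ ℚ.* t i) ≡ 0ℚ
  ∑≤-zero zero    t = ℚP.*-zeroˡ (t 0)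
  ∑≤-zero (suc r) t = cong₂ ℚ._+_ (ℚP.*-zeroˡ (t 0)) (∑≤-zero r (t ∘ suc))
coeff-*ₚ (a ∷ f) g zero    =
  trans (coeff-+ₚ (scaleₚ a g) _ 0) (trans (ℚP.+-identityʳ _) (coeff-scaleₚ a g 0))
coeff-*ₚ (a ∷ f) g (suc r) =
  trans (coeff-+ₚ (scaleₚ a g) _ (suc r)) (cong₂ ℚ._+_ (coeff-scaleₚ a g (suc r)) (coeff-*ₚ f g r))

coeff-≥length : ∀ f i → length f ≤ i → coeff f i ≡ 0ℚ
coeff-≥length []      i       _         = refl
coeff-≥length (a ∷ f) (suc i) (s≤s f≤i) = coeff-≥length f i f≤i

coeff-map-applyUpTo-< : ∀ (φ : ℕ → ℚ) f {m} i → i < m → coeff (map φ (applyUpTo f m)) i ≡ φ (f i)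
coeff-map-applyUpTo-< φ f zero    (s≤s _)   = refl
coeff-map-applyUpTo-< φ f (suc i) (s≤s i<m) = coeff-map-applyUpTo-< φ (f ∘ suc) i i<m

coeff-map-applyUpTo-≥ : ∀ (φ : ℕ → ℚ) f {m} i → m ≤ i → coeff (map φ (applyUpTo f m)) i ≡ 0ℚ
coeff-map-applyUpTo-≥ φ f {zero}  i       _         = refl
coeff-map-applyUpTo-≥ φ f {suc m} (suc i) (s≤s m≤i) = coeff-map-applyUpTo-≥ φ (f ∘ suc) i m≤i

toℚ-↥ : ∀ a → toℚ (↥ a) ≡ a ℚ.* toℚ (+ ↧ₙ a)
toℚ-↥ a@(mkℚ n d-1 _) = ℚP.toℚᵘ-injective (ℚᵘP.≃-trans (ℚP.toℚᵘ-fromℚᵘ (ℚᵘ.mkℚᵘ n 0)) (ℚᵘP.≃-trans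
  (ℚᵘ.*≡* n*d≡n*d*1)
  (ℚᵘP.≃-sym (ℚᵘP.≃-trans (ℚP.toℚᵘ-homo-* a (toℚ (+ suc d-1)))
                (ℚᵘP.*-congˡ {ℚ.toℚᵘ a} (ℚP.toℚᵘ-fromℚᵘ (ℚᵘ.mkℚᵘ (+ suc d-1) 0)))))))
  where
  n*d≡n*d*1 : n ℤ.* + (suc d-1 ℕ.* 1) ≡ n ℤ.* + suc d-1 ℤ.* + 1
  n*d≡n*d*1 = trans (cong (λ m → n ℤ.* + m) (ℕP.*-identityʳ (suc d-1))) (sym (ℤP.*-identityʳ _))

*≢0 : ∀ {x y} → x ≢ 0ℤ → y ≢ 0ℤ → x ℤ.* y ≢ 0ℤ
*≢0 {x} x≢0 y≢0 x*y≡0 = [ x≢0 , y≢0 ]′ (ℤP.i*j≡0⇒i≡0∨j≡0 x x*y≡0)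

Clears : ℤ → Poly → (ℕ → ℤ) → Set
Clears D f F = ∀ i → toℚ (F i) ≡ toℚ D ℚ.* coeff f i

clearDenominators : ∀ f → ∃₂ λ (D : ℤ) (F : ℕ → ℤ) → D ≢ 0ℤ × Clears D f F
clearDenominators []      = + 1 , (λ _ → 0ℤ) , (λ ()) , (λ _ → sym (ℚP.*-zeroʳ (toℚ (+ 1))))
clearDenominators (a ∷ f) with clearDenominators f
... | D , F , D≢0 , F≡D*f = d ℤ.* D , F′ , *≢0 {d} (λ ()) D≢0 , F′≡d*D*f
  where
  open ≡-Reasoning
  d : ℤ
  d = + ↧ₙ a
  F′ : ℕ → ℤ
  F′ zero    = ↥ a ℤ.* D
  F′ (suc i) = d ℤ.* F i
  F′≡d*D*f : Clears (d ℤ.* D) (a ∷ f) F′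
  F′≡d*D*f zero = begin
    toℚ (↥ a ℤ.* D)           ≡⟨ toℚ-* (↥ a) D ⟩
    toℚ (↥ a) ℚ.* toℚ D       ≡⟨ cong (ℚ._* toℚ D) (toℚ-↥ a) ⟩
    a ℚ.* toℚ d ℚ.* toℚ D     ≡⟨ ℚP.*-assoc a (toℚ d) (toℚ D) ⟩
    a ℚ.* (toℚ d ℚ.* toℚ D)   ≡⟨ ℚP.*-comm a _ ⟩
    (toℚ d ℚ.* toℚ D) ℚ.* a   ≡⟨ cong (ℚ._* a) (toℚ-* d D) ⟨
    toℚ (d ℤ.* D) ℚ.* a       ∎
  F′≡d*D*f (suc i) = begin
    toℚ (d ℤ.* F i)                 ≡⟨ toℚ-* d (F i) ⟩
    toℚ d ℚ.* toℚ (F i)             ≡⟨ cong (toℚ d ℚ.*_) (F≡D*f i) ⟩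
    toℚ d ℚ.* (toℚ D ℚ.* coeff f i) ≡⟨ ℚP.*-assoc (toℚ d) (toℚ D) _ ⟨
    toℚ d ℚ.* toℚ D ℚ.* coeff f i   ≡⟨ cong (ℚ._* coeff f i) (toℚ-* d D) ⟨
    toℚ (d ℤ.* D) ℚ.* coeff f i     ∎

toℚ-*-cancelˡ-≡0 : ∀ {D c} → D ≢ 0ℤ → toℚ D ℚ.* c ≡ 0ℚ → c ≡ 0ℚ
toℚ-*-cancelˡ-≡0 {D} {c} D≢0 D*c≡0 = begin
  c                               ≡⟨ ℚP.*-identityˡ c ⟨
  ℚ.1ℚ ℚ.* c                      ≡⟨ cong (ℚ._* c) (ℚP.*-inverseˡ (toℚ D)) ⟨
  ℚ.1/ toℚ D ℚ.* toℚ D ℚ.* c      ≡⟨ ℚP.*-assoc (ℚ.1/ toℚ D) (toℚ D) c ⟩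
  ℚ.1/ toℚ D ℚ.* (toℚ D ℚ.* c)    ≡⟨ cong (ℚ.1/ toℚ D ℚ.*_) D*c≡0 ⟩
  ℚ.1/ toℚ D ℚ.* 0ℚ               ≡⟨ ℚP.*-zeroʳ (ℚ.1/ toℚ D) ⟩
  0ℚ                              ∎
  where
  open ≡-Reasoning
  instance
    D≢0ℚ : ℚ.NonZero (toℚ D)
    D≢0ℚ = ℚ.≢-nonZero (D≢0 ∘ toℚ-injective)

Clears-≡0 : ∀ {D f F i} → Clears D f F → coeff f i ≡ 0ℚ → F i ≡ 0ℤ
Clears-≡0 {D} {i = i} F≡D*f fᵢ≡0 =
  toℚ-injective (trans (F≡D*f i) (trans (cong (toℚ D ℚ.*_) fᵢ≡0) (ℚP.*-zeroʳ (toℚ D))))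

Clears-≢0 : ∀ {D f F i} → D ≢ 0ℤ → Clears D f F → coeff f i ≢ 0ℚ → F i ≢ 0ℤ
Clears-≢0 {i = i} D≢0 F≡D*f fᵢ≢0 Fᵢ≡0 =
  fᵢ≢0 (toℚ-*-cancelˡ-≡0 D≢0 (trans (sym (F≡D*f i)) (cong toℚ Fᵢ≡0)))

_⋆_ : (ℕ → ℤ) → (ℕ → ℤ) → ℕ → ℤ
(G ⋆ H) r = ∑≤ ℤ._+_ r (λ i → G i ℤ.* H (r ∸ i))

⋆-clearDenominators : ∀ {f g h Dg Dh G H} → (g *ₚ h) ≈ₚ f → Clears Dg g G → Clears Dh h H →
                      ∀ {r x} → coeff f r ≡ toℚ x → (G ⋆ H) r ≡ (Dg ℤ.* Dh) ℤ.* x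
⋆-clearDenominators {f} {g} {h} {Dg} {Dh} {G} {H} gh≈f G≡Dg*g H≡Dh*h {r} {x} fᵣ≡x = toℚ-injective (begin
  toℚ ((G ⋆ H) r)
    ≡⟨ ∑≤-homo toℚ toℚ-+ r _ ⟩
  ∑≤ ℚ._+_ r (λ i → toℚ (G i ℤ.* H (r ∸ i)))
    ≡⟨ ∑≤-cong r termwise ⟩
  ∑≤ ℚ._+_ r (λ i → (toℚ Dg ℚ.* toℚ Dh) ℚ.* (coeff g i ℚ.* coeff h (r ∸ i)))
    ≡⟨ ∑≤-homo (toℚ Dg ℚ.* toℚ Dh ℚ.*_) (ℚP.*-distribˡ-+ (toℚ Dg ℚ.* toℚ Dh)) r _ ⟨
  (toℚ Dg ℚ.* toℚ Dh) ℚ.* ∑≤ ℚ._+_ r (λ i → coeff g i ℚ.* coeff h (r ∸ i))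
    ≡⟨ cong₂ ℚ._*_ (toℚ-* Dg Dh) (trans (sym (gh≈f r)) (coeff-*ₚ g h r)) ⟨
  toℚ (Dg ℤ.* Dh) ℚ.* coeff f r
    ≡⟨ cong (toℚ (Dg ℤ.* Dh) ℚ.*_) fᵣ≡x ⟩
  toℚ (Dg ℤ.* Dh) ℚ.* toℚ x
    ≡⟨ toℚ-* (Dg ℤ.* Dh) x ⟨
  toℚ ((Dg ℤ.* Dh) ℤ.* x)
    ∎)
  where
  open ≡-Reasoning
  termwise : ∀ i → toℚ (G i ℤ.* H (r ∸ i)) ≡ (toℚ Dg ℚ.* toℚ Dh) ℚ.* (coeff g i ℚ.* coeff h (r ∸ i))
  termwise i = trans (toℚ-* (G i) _) (trans (cong₂ ℚ._*_ (G≡Dg*g i) (H≡Dh*h (r ∸ i)))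
                                            (ℚ*.interchange (toℚ Dg) _ (toℚ Dh) _))

∑≤-∣ : ∀ {d} r t → (∀ i → i ≤ r → d ℤD.∣ t i) → d ℤD.∣ ∑≤ ℤ._+_ r t
∑≤-∣ zero    t d∣t = d∣t 0 z≤n
∑≤-∣ (suc r) t d∣t = ℤD.∣m∣n⇒∣m+n (d∣t 0 z≤n) (∑≤-∣ r (t ∘ suc) (λ i i≤r → d∣t (suc i) (s≤s i≤r)))

∑≤-∤ : ∀ {d} r t i → i ≤ r → ¬ d ℤD.∣ t i → (∀ j → j ≤ r → j ≢ i → d ℤD.∣ t j) → ¬ d ℤD.∣ ∑≤ ℤ._+_ r t
∑≤-∤ zero    t zero    _         d∤tᵢ _    = d∤tᵢ
∑≤-∤ (suc r) t zero    _         d∤t₀ d∣tⱼ d∣∑ =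
  d∤t₀ (ℤD.∣m+n∣n⇒∣m d∣∑ (∑≤-∣ r (t ∘ suc) (λ j j≤r → d∣tⱼ (suc j) (s≤s j≤r) λ ())))
∑≤-∤ (suc r) t (suc i) (s≤s i≤r) d∤tᵢ d∣tⱼ d∣∑ =
  ∑≤-∤ r (t ∘ suc) i i≤r d∤tᵢ (λ j j≤r j≢i → d∣tⱼ (suc j) (s≤s j≤r) (j≢i ∘ ℕP.suc-injective))
    (ℤD.∣m+n∣m⇒∣n d∣∑ (d∣tⱼ 0 z≤n λ ()))

∸-<-of-<-+ : ∀ {a b j r} → a ≤ j → j ≤ r → r < a ℕ.+ b → r ∸ j < b
∸-<-of-<-+ {a} {b} {j} {r} a≤j j≤r r<a+b = ℕP.+-cancelˡ-< a (r ∸ j) b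
  (ℕP.≤-<-trans (subst (a ℕ.+ (r ∸ j) ≤_) (ℕP.m+[n∸m]≡n j≤r) (ℕP.+-monoˡ-≤ (r ∸ j) a≤j)) r<a+b)

<-∸-of-+-< : ∀ {a b j r} → j ≤ a → a ℕ.+ b < r → b < r ∸ j
<-∸-of-+-< {a} {b} {j} {r} j≤a a+b<r = ℕP.+-cancelˡ-< j b (r ∸ j)
  (subst (j ℕ.+ b <_) (sym (ℕP.m+[n∸m]≡n j≤r)) (ℕP.≤-<-trans (ℕP.+-monoˡ-≤ b j≤a) a+b<r))
  where
  j≤r : j ≤ r
  j≤r = ℕP.<⇒≤ (ℕP.≤-<-trans (ℕP.≤-trans j≤a (ℕP.m≤m+n a b)) a+b<r)

^-monoʳ-∣ : ∀ m {a b} → a ≤ b → m ^ a ∣ m ^ b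
^-monoʳ-∣ m {a} {b} a≤b =
  divides (m ^ (b ∸ a)) (trans (cong (m ^_) (sym (ℕP.m∸n+n≡m a≤b))) (ℕP.^-distribˡ-+-* m (b ∸ a) a))

module Valuation (p : ℕ) (p-prime : Prime p) where

  instance
    p≢0 : ℕ.NonZero p
    p≢0 = prime⇒nonZero p-prime

  1<p : 1 < p
  1<p = ℕ.nonTrivial⇒n>1 p {{prime⇒nonTrivial p-prime}}

  p^≢0 : ∀ c → ℕ.NonZero (p ^ c)
  p^≢0 c = ℕP.m^n≢0 p c

  valEq-*p^ : ∀ {u} c → ¬ p ∣ u → ValEq p (u ℕ.* p ^ c) c
  valEq-*p^ {u} c p∤u = n∣m*n u , λ p*p^c∣u*p^c → p∤u (ℕD.*-cancelʳ-∣ (p ^ c) {{p^≢0 c}} p*p^c∣u*p^c)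

  valEq⇒*p^ : ∀ {x a} → ValEq p x a → ∃ λ u → ¬ p ∣ u × x ≡ u ℕ.* p ^ a
  valEq⇒*p^ {a = a} (divides u x≡u*p^a , p^1+a∤x) =
    u , (λ { (divides w refl) → p^1+a∤x (divides w (trans x≡u*p^a (ℕP.*-assoc w p (p ^ a)))) }) , x≡u*p^a

  valEq-* : ∀ {x y a b} → ValEq p x a → ValEq p y b → ValEq p (x ℕ.* y) (a ℕ.+ b)
  valEq-* {x} {y} {a} {b} vx vy with valEq⇒*p^ {x} {a} vx | valEq⇒*p^ {y} {b} vy
  ... | u , p∤u , refl | w , p∤w , refl =
    subst (λ z → ValEq p z (a ℕ.+ b)) (sym rearrange) (valEq-*p^ (a ℕ.+ b) p∤u*w)
    where
    p∤u*w : ¬ p ∣ u ℕ.* w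
    p∤u*w p∣u*w with euclidsLemma u w p-prime p∣u*w
    ... | inj₁ p∣u = p∤u p∣u
    ... | inj₂ p∣w = p∤w p∣w
    rearrange : u ℕ.* p ^ a ℕ.* (w ℕ.* p ^ b) ≡ u ℕ.* w ℕ.* p ^ (a ℕ.+ b)
    rearrange = trans (ℕ*.interchange u (p ^ a) w (p ^ b))
                      (cong (u ℕ.* w ℕ.*_) (sym (ℕP.^-distribˡ-+-* p a b)))

  p∤1 : ¬ p ∣ 1
  p∤1 p∣1 = ℕP.<⇒≱ 1<p (ℕD.∣⇒≤ p∣1)

  valEq-0 : ∀ {x} → ¬ p ∣ x → ValEq p x 0
  valEq-0 {x} p∤x = subst (λ z → ValEq p z 0) (ℕP.*-identityʳ x) (valEq-*p^ 0 p∤x)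

  valEq-p : ValEq p p 1
  valEq-p = subst (λ z → ValEq p z 1) (trans (ℕP.*-identityˡ _) (ℕP.*-identityʳ p)) (valEq-*p^ 1 p∤1)

  valEq-≢0 : ∀ {x v} → ValEq p x v → x ≢ 0
  valEq-≢0 (_ , p^1+v∤x) refl = p^1+v∤x (_ ∣0)

  p^∣⇒≤valEq : ∀ {x c v} → p ^ c ∣ x → ValEq p x v → c ≤ v
  p^∣⇒≤valEq {c = c} {v} p^c∣x (_ , p^1+v∤x) with c ℕ.≤? v
  ... | yes c≤v = c≤v
  ... | no c≰v  = ⊥-elim (p^1+v∤x (ℕD.∣-trans (^-monoʳ-∣ p (ℕP.≰⇒> c≰v)) p^c∣x))

  ≤valEq⇒p^∣ : ∀ {x c v} → c ≤ v → ValEq p x v → p ^ c ∣ x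
  ≤valEq⇒p^∣ c≤v (p^v∣x , _) = ℕD.∣-trans (^-monoʳ-∣ p c≤v) p^v∣x

  valEq-unique : ∀ {x a b} → ValEq p x a → ValEq p x b → a ≡ b
  valEq-unique va vb = ℕP.≤-antisym (p^∣⇒≤valEq (proj₁ va) vb) (p^∣⇒≤valEq (proj₁ vb) va)

  valEq-exists : ∀ x → x ≢ 0 → ∃ (ValEq p x)
  valEq-exists x = go x (<-wellFounded x)
    where
    go : ∀ x → Acc _<_ x → x ≢ 0 → ∃ (ValEq p x)
    go x (acc smaller) x≢0 with p ℕD.∣? x
    ... | no p∤x = 0 , valEq-0 p∤x
    ... | yes (divides q refl) =
      let v , vq = go q (smaller q<q*p) q≢0
      in suc v , subst (λ z → ValEq p z (suc v)) (ℕP.*-comm p q) (valEq-* {a = 1} {b = v} valEq-p vq)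
      where
      q≢0 : q ≢ 0
      q≢0 refl = x≢0 refl
      q<q*p : q < q ℕ.* p
      q<q*p = ℕP.m<m*n q p {{ℕ.≢-nonZero q≢0}} 1<p

  νℕ : ℕ → ℕ
  νℕ zero        = 0
  νℕ m@(suc _)   = proj₁ (valEq-exists m λ ())

  νℕ-valEq : ∀ m → m ≢ 0 → ValEq p m (νℕ m)
  νℕ-valEq zero    0≢0 = ⊥-elim (0≢0 refl)
  νℕ-valEq (suc m) _   = proj₂ (valEq-exists (suc m) λ ())

  -- ν 0ℤ = 0 is a junk value, harmless because p ^ ν x still divides x.
  ν : ℤ → ℕ
  ν x = νℕ ∣ x ∣

  ν-valEq : ∀ {x} → x ≢ 0ℤ → ValEq p ∣ x ∣ (ν x)
  ν-valEq {x} x≢0 = νℕ-valEq ∣ x ∣ (x≢0 ∘ ℤP.∣i∣≡0⇒i≡0)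

  ν-unique : ∀ {x v} → ValEq p ∣ x ∣ v → ν x ≡ v
  ν-unique {x} {v} vx =
    valEq-unique {∣ x ∣} {ν x} {v} (ν-valEq {x} (λ { refl → valEq-≢0 {v = v} vx refl })) vx

  ν-* : ∀ {x y} → x ≢ 0ℤ → y ≢ 0ℤ → ν (x ℤ.* y) ≡ ν x ℕ.+ ν y
  ν-* {x} {y} x≢0 y≢0 =
    ν-unique {x ℤ.* y} (subst (λ z → ValEq p z (ν x ℕ.+ ν y)) (sym (ℤP.abs-* x y))
      (valEq-* {∣ x ∣} {∣ y ∣} {ν x} {ν y} (ν-valEq {x} x≢0) (ν-valEq {y} y≢0)))

  p^_∣ᶻ_ : ℕ → ℤ → Set
  p^ c ∣ᶻ x = + (p ^ c) ℤD.∣ x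

  p^ν∣ᶻ : ∀ x → p^ ν x ∣ᶻ x
  p^ν∣ᶻ x with ∣ x ∣ ℕ.≟ 0
  ... | yes ∣x∣≡0 = ℤD.∣ᵤ⇒∣ (subst (p ^ ν x ∣_) (sym ∣x∣≡0) (_ ∣0))
  ... | no ∣x∣≢0  = ℤD.∣ᵤ⇒∣ (proj₁ (νℕ-valEq ∣ x ∣ ∣x∣≢0))

  ∣ᶻ⇒≤ν : ∀ {x c} → x ≢ 0ℤ → p^ c ∣ᶻ x → c ≤ ν x
  ∣ᶻ⇒≤ν x≢0 p^c∣x = p^∣⇒≤valEq (ℤD.∣⇒∣ᵤ p^c∣x) (ν-valEq x≢0)

  ≤ν⇒∣ᶻ : ∀ {x c} → c ≤ ν x → p^ c ∣ᶻ x
  ≤ν⇒∣ᶻ {x} c≤ν = ℤD.∣-trans (ℤD.∣ᵤ⇒∣ (^-monoʳ-∣ p c≤ν)) (p^ν∣ᶻ x)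

  p^1+ν∤ᶻ : ∀ {x} → x ≢ 0ℤ → ¬ p^ suc (ν x) ∣ᶻ x
  p^1+ν∤ᶻ x≢0 p^1+ν∣x = proj₂ (ν-valEq x≢0) (ℤD.∣⇒∣ᵤ p^1+ν∣x)

  ν-+ : ∀ {x y} → x ℤ.+ y ≢ 0ℤ → ν x ⊓ ν y ≤ ν (x ℤ.+ y)
  ν-+ {x} {y} x+y≢0 =
    ∣ᶻ⇒≤ν x+y≢0 (ℤD.∣m∣n⇒∣m+n (≤ν⇒∣ᶻ {x} (ℕP.m⊓n≤m _ _)) (≤ν⇒∣ᶻ {y} (ℕP.m⊓n≤n (ν x) _)))

  ν-∑≤-dominant : ∀ r t i → i ≤ r → t i ≢ 0ℤ → (∀ j → j ≤ r → j ≢ i → t j ≡ 0ℤ ⊎ ν (t i) < ν (t j)) →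
                  ∑≤ ℤ._+_ r t ≢ 0ℤ × ν (∑≤ ℤ._+_ r t) ≡ ν (t i)
  ν-∑≤-dominant r t i i≤r tᵢ≢0 others = ∑≢0 , ℕP.≤-antisym ν∑≤νtᵢ νtᵢ≤ν∑
    where
    p^1+νtᵢ∣tⱼ : ∀ j → j ≤ r → j ≢ i → p^ suc (ν (t i)) ∣ᶻ t j
    p^1+νtᵢ∣tⱼ j j≤r j≢i with others j j≤r j≢i
    ... | inj₁ tⱼ≡0  = subst (p^ suc (ν (t i)) ∣ᶻ_) (sym tⱼ≡0) (ℤD.∣ᵤ⇒∣ (_ ∣0))
    ... | inj₂ νtᵢ<νtⱼ = ≤ν⇒∣ᶻ {t j} νtᵢ<νtⱼ
    p^1+νtᵢ∤∑ : ¬ p^ suc (ν (t i)) ∣ᶻ ∑≤ ℤ._+_ r t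
    p^1+νtᵢ∤∑ = ∑≤-∤ r t i i≤r (p^1+ν∤ᶻ tᵢ≢0) p^1+νtᵢ∣tⱼ
    ∑≢0 : ∑≤ ℤ._+_ r t ≢ 0ℤ
    ∑≢0 ∑≡0 = p^1+νtᵢ∤∑ (subst (p^ suc (ν (t i)) ∣ᶻ_) (sym ∑≡0) (ℤD.∣ᵤ⇒∣ (_ ∣0)))
    νtᵢ≤ν∑ : ν (t i) ≤ ν (∑≤ ℤ._+_ r t)
    νtᵢ≤ν∑ = ∣ᶻ⇒≤ν ∑≢0 (∑≤-∣ r t p^νtᵢ∣tⱼ)
      where
      p^νtᵢ∣tⱼ : ∀ j → j ≤ r → p^ ν (t i) ∣ᶻ t j
      p^νtᵢ∣tⱼ j j≤r with j ℕ.≟ i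
      ... | yes refl = p^ν∣ᶻ (t j)
      ... | no j≢i   = ℤD.∣-trans (ℤD.∣ᵤ⇒∣ (^-monoʳ-∣ p (ℕP.n≤1+n (ν (t i))))) (p^1+νtᵢ∣tⱼ j j≤r j≢i)
    ν∑≤νtᵢ : ν (∑≤ ℤ._+_ r t) ≤ ν (t i)
    ν∑≤νtᵢ = ℕP.≮⇒≥ (λ νtᵢ<ν∑ → p^1+νtᵢ∤∑ (≤ν⇒∣ᶻ νtᵢ<ν∑))

  module _ {Q : ℕ → Set} (Q-upward : ∀ {a b} → a ≤ b → Q a → Q b) where

    ν-+-upward : ∀ x y → x ≡ 0ℤ ⊎ Q (ν x) → y ≡ 0ℤ ⊎ Q (ν y) → x ℤ.+ y ≡ 0ℤ ⊎ Q (ν (x ℤ.+ y))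
    ν-+-upward x y (inj₁ refl) qy = subst (λ z → z ≡ 0ℤ ⊎ Q (ν z)) (sym (ℤP.+-identityˡ y)) qy
    ν-+-upward x y (inj₂ qx) (inj₁ refl) =
      subst (λ z → z ≡ 0ℤ ⊎ Q (ν z)) (sym (ℤP.+-identityʳ x)) (inj₂ qx)
    ν-+-upward x y (inj₂ qx) (inj₂ qy) with x ℤ.+ y ℤ.≟ 0ℤ
    ... | yes x+y≡0 = inj₁ x+y≡0
    ... | no x+y≢0  = inj₂ (Q-upward (ν-+ {x} {y} x+y≢0) q⊓)
      where
      q⊓ : Q (ν x ⊓ ν y)
      q⊓ with ℕP.⊓-sel (ν x) (ν y)
      ... | inj₁ ⊓≡νx = subst Q (sym ⊓≡νx) qx
      ... | inj₂ ⊓≡νy = subst Q (sym ⊓≡νy) qy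

    ν-∑≤-upward : ∀ r t → (∀ i → i ≤ r → t i ≡ 0ℤ ⊎ Q (ν (t i))) →
                  ∑≤ ℤ._+_ r t ≡ 0ℤ ⊎ Q (ν (∑≤ ℤ._+_ r t))
    ν-∑≤-upward zero    t qt = qt 0 z≤n
    ν-∑≤-upward (suc r) t qt =
      ν-+-upward (t 0) _ (qt 0 z≤n) (ν-∑≤-upward r (t ∘ suc) (λ i i≤r → qt (suc i) (s≤s i≤r)))

module _ {Q : ℕ → Set} (Q? : Decidable Q) where

  leastBelow : ∀ n → (∀ j → j < n → ¬ Q j) ⊎ ∃ λ i → Q i × (∀ j → j < i → ¬ Q j)
  leastBelow zero = inj₁ λ _ ()
  leastBelow (suc n) with leastBelow n
  ... | inj₂ found = inj₂ found
  ... | inj₁ none with Q? n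
  ...   | yes qn = inj₂ (n , qn , none)
  ...   | no ¬qn = inj₁ λ j j<1+n → [ none j , (λ { refl → ¬qn }) ]′ (ℕP.m≤n⇒m<n∨m≡n (ℕP.≤-pred j<1+n))

  least : ∀ {i} → Q i → ∃ λ i₀ → Q i₀ × (∀ j → j < i₀ → ¬ Q j)
  least {i} qi = [ (λ none → ⊥-elim (none i ℕP.≤-refl qi)) , id ]′ (leastBelow (suc i))

  greatest : ∀ D → (∀ j → Q j → j ≤ D) → ∀ {i} → Q i → ∃ λ i₁ → Q i₁ × (∀ j → i₁ < j → ¬ Q j)
  greatest D bound qi with Q? D
  ... | yes qD = D , qD , λ j D<j qj → ℕP.<⇒≱ D<j (bound j qj)
  greatest zero    bound {i} qi | no ¬q0 with bound i qi
  ... | z≤n = ⊥-elim (¬q0 qi)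
  greatest (suc D) bound     qi | no ¬qD = greatest D bound′ qi
    where
    bound′ : ∀ j → Q j → j ≤ D
    bound′ j qj = ℕP.≤-pred (ℕP.≤∧≢⇒< (bound j qj) λ { refl → ¬qD qj })

record MinimalWeight (w : ℕ → ℤ) (P : ℕ → Set) : Set where
  field
    min         : ℤ
    first last  : ℕ
    P-first     : P first
    P-last      : P last
    w-first     : w first ≡ min
    w-last      : w last ≡ min
    min≤        : ∀ j → P j → min ℤ.≤ w j
    min<-before : ∀ j → j < first → P j → min ℤ.< w j
    min<-after  : ∀ j → last < j → P j → min ℤ.< w j

module _ (w : ℕ → ℤ) {P : ℕ → Set} (P? : Decidable P) where

  private
    improve : ∀ {c} → P c → ∀ j → ∃ λ i → P i × w i ℤ.≤ w c × (P j → w i ℤ.≤ w j)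
    improve {c} pc j with P? j | w j ℤ.≤? w c
    ... | yes pj | yes wj≤wc = j , pj , wj≤wc , λ _ → ℤP.≤-refl
    ... | yes _  | no wj≰wc  = c , pc , ℤP.≤-refl , λ _ → ℤP.<⇒≤ (ℤP.≰⇒> wj≰wc)
    ... | no ¬pj | _         = c , pc , ℤP.≤-refl , λ pj → ⊥-elim (¬pj pj)

  argminUpTo : ∀ D {c} → P c → ∃ λ i → P i × (∀ j → j ≤ D → P j → w i ℤ.≤ w j)
  argminUpTo zero pc with improve pc 0
  ... | i , pi , _ , i≤0 = i , pi , λ { .0 z≤n → i≤0 }
  argminUpTo (suc D) pc with argminUpTo D pc
  ... | i , pi , i≤ with improve pi (suc D)
  ... | i′ , pi′ , i′≤i , i′≤1+D = i′ , pi′ , i′≤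
    where
    i′≤ : ∀ j → j ≤ suc D → P j → w i′ ℤ.≤ w j
    i′≤ j j≤1+D pj with ℕP.m≤n⇒m<n∨m≡n j≤1+D
    ... | inj₁ j<1+D = ℤP.≤-trans i′≤i (i≤ j (ℕP.≤-pred j<1+D) pj)
    ... | inj₂ refl  = i′≤1+D pj

  minimalWeight : ∀ D → (∀ j → P j → j ≤ D) → ∀ {c} → P c → MinimalWeight w P
  minimalWeight D bound pc with argminUpTo D pc
  ... | i , pi , i≤ = record
    { min = w i ; first = proj₁ F ; last = proj₁ L
    ; P-first = proj₁ (proj₁ (proj₂ F)) ; P-last = proj₁ (proj₁ (proj₂ L))
    ; w-first = proj₂ (proj₁ (proj₂ F)) ; w-last = proj₂ (proj₁ (proj₂ L))
    ; min≤ = min≤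
    ; min<-before = λ j j<first pj → strict j pj (proj₂ (proj₂ F) j j<first)
    ; min<-after = λ j last<j pj → strict j pj (proj₂ (proj₂ L) j last<j)
    }
    where
    Minimiser : ℕ → Set
    Minimiser j = P j × w j ≡ w i
    minimiser? : Decidable Minimiser
    minimiser? j = P? j ×-dec (w j ℤ.≟ w i)
    F : ∃ λ f → Minimiser f × (∀ j → j < f → ¬ Minimiser j)
    F = least minimiser? (pi , refl)
    L : ∃ λ l → Minimiser l × (∀ j → l < j → ¬ Minimiser j)
    L = greatest minimiser? D (λ j → bound j ∘ proj₁) (pi , refl)
    min≤ : ∀ j → P j → w i ℤ.≤ w j
    min≤ j pj = i≤ j (bound j pj) pj
    strict : ∀ j → P j → ¬ Minimiser j → w i ℤ.< w j
    strict j pj ¬min = ℤP.≤∧≢⇒< (min≤ j pj) (λ wi≡wj → ¬min (pj , sym wi≡wj))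

Degree : (ℕ → ℤ) → ℕ → Set
Degree F d = F d ≢ 0ℤ × (∀ i → d < i → F i ≡ 0ℤ)

≢0? : (F : ℕ → ℤ) → Decidable (λ i → F i ≢ 0ℤ)
≢0? F i = ¬? (F i ℤ.≟ 0ℤ)

≢0⇒≤bound : ∀ {F : ℕ → ℤ} {D i} → (∀ j → D < j → F j ≡ 0ℤ) → F i ≢ 0ℤ → i ≤ D
≢0⇒≤bound {i = i} vanishes Fᵢ≢0 = ℕP.≮⇒≥ (λ D<i → Fᵢ≢0 (vanishes i D<i))

degree-exists : ∀ {F : ℕ → ℤ} {D i} → (∀ j → D < j → F j ≡ 0ℤ) → F i ≢ 0ℤ → ∃ (Degree F)
degree-exists {F} {D} vanishes Fᵢ≢0 with greatest (≢0? F) D (λ j → ≢0⇒≤bound {F} vanishes) Fᵢ≢0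
... | d , F_d≢0 , above = d , F_d≢0 , λ j d<j → decidable-stable (F j ℤ.≟ 0ℤ) (above j d<j)

+-cancelʳ-<ᶻ : ∀ {a b} c → a ℤ.+ c ℤ.< b ℤ.+ c → a ℤ.< b
+-cancelʳ-<ᶻ {a} {b} c a+c<b+c = subst₂ ℤ._<_ (cancel a) (cancel b) (ℤP.+-monoˡ-< (ℤ.- c) a+c<b+c)
  where
  cancel : ∀ x → x ℤ.+ c ℤ.+ ℤ.- c ≡ x
  cancel x = trans (ℤP.+-assoc x c (ℤ.- c))
                   (trans (cong (λ z → x ℤ.+ z) (ℤP.+-inverseʳ c)) (ℤP.+-identityʳ x))

module Weight (p : ℕ) (p-prime : Prime p) (k : ℕ) (s : ℤ) where

  open Valuation p p-prime public

  W : ℤ → ℕ → ℤ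
  W x i = + (k ℕ.* ν x) ℤ.+ s ℤ.* + i

  W-* : ∀ {x y} i j → x ≢ 0ℤ → y ≢ 0ℤ → W (x ℤ.* y) (i ℕ.+ j) ≡ W x i ℤ.+ W y j
  W-* {x} {y} i j x≢0 y≢0 = begin
    + (k ℕ.* ν (x ℤ.* y)) ℤ.+ s ℤ.* + (i ℕ.+ j)
      ≡⟨ cong₂ (λ v l → + (k ℕ.* v) ℤ.+ s ℤ.* l) (ν-* x≢0 y≢0) (ℤP.pos-+ i j) ⟩
    + (k ℕ.* (ν x ℕ.+ ν y)) ℤ.+ s ℤ.* (+ i ℤ.+ + j)
      ≡⟨ cong₂ ℤ._+_ (trans (cong +_ (ℕP.*-distribˡ-+ k (ν x) (ν y))) (ℤP.pos-+ (k ℕ.* ν x) _))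
                     (ℤP.*-distribˡ-+ s (+ i) (+ j)) ⟩
    (+ (k ℕ.* ν x) ℤ.+ + (k ℕ.* ν y)) ℤ.+ (s ℤ.* + i ℤ.+ s ℤ.* + j)
      ≡⟨ ℤ+.interchange (+ (k ℕ.* ν x)) (+ (k ℕ.* ν y)) (s ℤ.* + i) (s ℤ.* + j) ⟩
    W x i ℤ.+ W y j
      ∎
    where open ≡-Reasoning

  W-<⇒ν-< : ∀ {x y r} → W x r ℤ.< W y r → ν x < ν y
  W-<⇒ν-< {x} {y} {r} Wx<Wy = ℕP.*-cancelˡ-< k (ν x) (ν y) (ℤP.drop‿+<+ (+-cancelʳ-<ᶻ (s ℤ.* + r) Wx<Wy))

  module _ (G H : ℕ → ℤ) where

    termWeight : ℕ → ℕ → ℤ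
    termWeight r j = W (G j) j ℤ.+ W (H (r ∸ j)) (r ∸ j)

    W-term : ∀ {r j} → j ≤ r → G j ≢ 0ℤ → H (r ∸ j) ≢ 0ℤ → W (G j ℤ.* H (r ∸ j)) r ≡ termWeight r j
    W-term {r} {j} j≤r Gⱼ≢0 Hᵣ₋ⱼ≢0 =
      subst (λ z → W (G j ℤ.* H (r ∸ j)) z ≡ termWeight r j) (ℕP.m+[n∸m]≡n j≤r)
            (W-* j (r ∸ j) Gⱼ≢0 Hᵣ₋ⱼ≢0)

    term≡0⊎factors≢0 : ∀ r j → G j ℤ.* H (r ∸ j) ≡ 0ℤ ⊎ (G j ≢ 0ℤ × H (r ∸ j) ≢ 0ℤ)
    term≡0⊎factors≢0 r j with G j ℤ.≟ 0ℤ | H (r ∸ j) ℤ.≟ 0ℤ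
    ... | yes Gⱼ≡0 | _          = inj₁ (cong (ℤ._* H (r ∸ j)) Gⱼ≡0)
    ... | no _     | yes Hᵣ₋ⱼ≡0 = inj₁ (trans (cong (G j ℤ.*_) Hᵣ₋ⱼ≡0) (ℤP.*-zeroʳ (G j)))
    ... | no Gⱼ≢0  | no Hᵣ₋ⱼ≢0  = inj₂ (Gⱼ≢0 , Hᵣ₋ⱼ≢0)

    ⋆-dominant : ∀ {r i} → i ≤ r → G i ≢ 0ℤ → H (r ∸ i) ≢ 0ℤ →
                 (∀ j → j ≤ r → j ≢ i → G j ≢ 0ℤ → H (r ∸ j) ≢ 0ℤ → termWeight r i ℤ.< termWeight r j) →
                 (G ⋆ H) r ≢ 0ℤ × W ((G ⋆ H) r) r ≡ termWeight r i
    ⋆-dominant {r} {i} i≤r Gᵢ≢0 Hᵣ₋ᵢ≢0 lighter with ν-∑≤-dominant r t i i≤r tᵢ≢0 others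
      where
      t : ℕ → ℤ
      t j = G j ℤ.* H (r ∸ j)
      tᵢ≢0 : t i ≢ 0ℤ
      tᵢ≢0 = *≢0 Gᵢ≢0 Hᵣ₋ᵢ≢0
      others : ∀ j → j ≤ r → j ≢ i → t j ≡ 0ℤ ⊎ ν (t i) < ν (t j)
      others j j≤r j≢i with term≡0⊎factors≢0 r j
      ... | inj₁ tⱼ≡0               = inj₁ tⱼ≡0
      ... | inj₂ (Gⱼ≢0 , Hᵣ₋ⱼ≢0) = inj₂ (W-<⇒ν-< {t i} {t j} {r}
              (subst₂ ℤ._<_ (sym (W-term i≤r Gᵢ≢0 Hᵣ₋ᵢ≢0)) (sym (W-term j≤r Gⱼ≢0 Hᵣ₋ⱼ≢0))
                            (lighter j j≤r j≢i Gⱼ≢0 Hᵣ₋ⱼ≢0)))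
    ... | ⋆≢0 , ν⋆≡νtᵢ =
      ⋆≢0 , trans (cong (λ v → + (k ℕ.* v) ℤ.+ s ℤ.* + r) ν⋆≡νtᵢ) (W-term i≤r Gᵢ≢0 Hᵣ₋ᵢ≢0)

    ⋆-above : ∀ {r M} → (∀ j → j ≤ r → G j ≢ 0ℤ → H (r ∸ j) ≢ 0ℤ → M ℤ.< termWeight r j) →
              (G ⋆ H) r ≡ 0ℤ ⊎ M ℤ.< W ((G ⋆ H) r) r
    ⋆-above {r} {M} heavier = ν-∑≤-upward Q-upward r _ terms
      where
      Q : ℕ → Set
      Q v = M ℤ.< + (k ℕ.* v) ℤ.+ s ℤ.* + r
      Q-upward : ∀ {a b} → a ≤ b → Q a → Q b
      Q-upward a≤b q = ℤP.<-≤-trans q (ℤP.+-monoˡ-≤ (s ℤ.* + r) (ℤ.+≤+ (ℕP.*-monoʳ-≤ k a≤b)))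
      terms : ∀ j → j ≤ r → G j ℤ.* H (r ∸ j) ≡ 0ℤ ⊎ Q (ν (G j ℤ.* H (r ∸ j)))
      terms j j≤r with term≡0⊎factors≢0 r j
      ... | inj₁ tⱼ≡0               = inj₁ tⱼ≡0
      ... | inj₂ (Gⱼ≢0 , Hᵣ₋ⱼ≢0) =
        inj₂ (subst (M ℤ.<_) (sym (W-term j≤r Gⱼ≢0 Hᵣ₋ⱼ≢0)) (heavier j j≤r Gⱼ≢0 Hᵣ₋ⱼ≢0))

    ⋆-leading : ∀ {d e} → Degree G d → Degree H e → (G ⋆ H) (d ℕ.+ e) ≢ 0ℤ
    ⋆-leading {d} {e} (G_d≢0 , G-vanishes) (H_e≢0 , H-vanishes) =
      proj₁ (⋆-dominant (ℕP.m≤m+n d e) G_d≢0 (subst (λ z → H z ≢ 0ℤ) (sym (ℕP.m+n∸m≡n d e)) H_e≢0)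
                        noOther)
      where
      noOther : ∀ j → j ≤ d ℕ.+ e → j ≢ d → G j ≢ 0ℤ → H (d ℕ.+ e ∸ j) ≢ 0ℤ →
                termWeight (d ℕ.+ e) d ℤ.< termWeight (d ℕ.+ e) j
      noOther j _ j≢d Gⱼ≢0 Hᵣ₋ⱼ≢0 =
        ⊥-elim (Hᵣ₋ⱼ≢0 (H-vanishes _ (<-∸-of-+-< ℕP.≤-refl (ℕP.+-monoˡ-< e j<d))))
        where
        j<d : j < d
        j<d = ℕP.≤∧≢⇒< (≢0⇒≤bound G-vanishes Gⱼ≢0) j≢d

    module _ (A : MinimalWeight (λ i → W (G i) i) (λ i → G i ≢ 0ℤ))
             (B : MinimalWeight (λ i → W (H i) i) (λ i → H i ≢ 0ℤ)) where

      private
        module A = MinimalWeight A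
        module B = MinimalWeight B

      StrictlyAbove : ℕ → ℕ → Set
      StrictlyAbove r j = A.min ℤ.< W (G j) j ⊎ B.min ℤ.< W (H (r ∸ j)) (r ∸ j)

      strictlyAbove : ∀ {r j} → G j ≢ 0ℤ → H (r ∸ j) ≢ 0ℤ → StrictlyAbove r j →
                      A.min ℤ.+ B.min ℤ.< termWeight r j
      strictlyAbove Gⱼ≢0 Hᵣ₋ⱼ≢0 (inj₁ A<) = ℤP.+-mono-<-≤ A< (B.min≤ _ Hᵣ₋ⱼ≢0)
      strictlyAbove Gⱼ≢0 Hᵣ₋ⱼ≢0 (inj₂ B<) = ℤP.+-mono-≤-< (A.min≤ _ Gⱼ≢0) B<

      ⋆-minimalAt : ∀ {i i′} → G i ≢ 0ℤ → H i′ ≢ 0ℤ → W (G i) i ≡ A.min → W (H i′) i′ ≡ B.min →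
        (∀ j → j ≤ i ℕ.+ i′ → j ≢ i → G j ≢ 0ℤ → H (i ℕ.+ i′ ∸ j) ≢ 0ℤ → StrictlyAbove (i ℕ.+ i′) j) →
        (G ⋆ H) (i ℕ.+ i′) ≢ 0ℤ × W ((G ⋆ H) (i ℕ.+ i′)) (i ℕ.+ i′) ≡ A.min ℤ.+ B.min
      ⋆-minimalAt {i} {i′} Gᵢ≢0 Hᵢ′≢0 WGᵢ≡ WHᵢ′≡ strict =
        proj₁ dominant , trans (proj₂ dominant) weight
        where
        i+i′∸i≡i′ : i ℕ.+ i′ ∸ i ≡ i′
        i+i′∸i≡i′ = ℕP.m+n∸m≡n i i′
        weight : termWeight (i ℕ.+ i′) i ≡ A.min ℤ.+ B.min
        weight = cong₂ ℤ._+_ WGᵢ≡ (trans (cong (λ z → W (H z) z) i+i′∸i≡i′) WHᵢ′≡)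
        dominant : (G ⋆ H) (i ℕ.+ i′) ≢ 0ℤ × W ((G ⋆ H) (i ℕ.+ i′)) (i ℕ.+ i′) ≡ termWeight (i ℕ.+ i′) i
        dominant = ⋆-dominant (ℕP.m≤m+n i i′) Gᵢ≢0 (subst (λ z → H z ≢ 0ℤ) (sym i+i′∸i≡i′) Hᵢ′≢0)
          (λ j j≤r j≢i Gⱼ≢0 Hᵣ₋ⱼ≢0 →
            subst (ℤ._< _) (sym weight) (strictlyAbove Gⱼ≢0 Hᵣ₋ⱼ≢0 (strict j j≤r j≢i Gⱼ≢0 Hᵣ₋ⱼ≢0)))

      ⋆-first : (G ⋆ H) (A.first ℕ.+ B.first) ≢ 0ℤ ×
                W ((G ⋆ H) (A.first ℕ.+ B.first)) (A.first ℕ.+ B.first) ≡ A.min ℤ.+ B.min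
      ⋆-first = ⋆-minimalAt A.P-first B.P-first A.w-first B.w-first strict
        where
        strict : ∀ j → j ≤ A.first ℕ.+ B.first → j ≢ A.first → G j ≢ 0ℤ →
                 H (A.first ℕ.+ B.first ∸ j) ≢ 0ℤ → StrictlyAbove (A.first ℕ.+ B.first) j
        strict j j≤r j≢first Gⱼ≢0 Hᵣ₋ⱼ≢0 with ℕP.<-cmp j A.first
        ... | tri< j<first _ _ = inj₁ (A.min<-before j j<first Gⱼ≢0)
        ... | tri≈ _ j≡first _ = ⊥-elim (j≢first j≡first)
        ... | tri> _ _ first<j =
          inj₂ (B.min<-before _ (∸-<-of-<-+ first<j j≤r (ℕP.n<1+n _)) Hᵣ₋ⱼ≢0)

      ⋆-last : (G ⋆ H) (A.last ℕ.+ B.last) ≢ 0ℤ ×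
               W ((G ⋆ H) (A.last ℕ.+ B.last)) (A.last ℕ.+ B.last) ≡ A.min ℤ.+ B.min
      ⋆-last = ⋆-minimalAt A.P-last B.P-last A.w-last B.w-last strict
        where
        strict : ∀ j → j ≤ A.last ℕ.+ B.last → j ≢ A.last → G j ≢ 0ℤ → H (A.last ℕ.+ B.last ∸ j) ≢ 0ℤ →
                 StrictlyAbove (A.last ℕ.+ B.last) j
        strict j j≤r j≢last Gⱼ≢0 Hᵣ₋ⱼ≢0 with ℕP.<-cmp j A.last
        ... | tri< j<last _ _ =
          inj₂ (B.min<-after _ (<-∸-of-+-< ℕP.≤-refl (ℕP.+-monoˡ-< B.last j<last)) Hᵣ₋ⱼ≢0)
        ... | tri≈ _ j≡last _ = ⊥-elim (j≢last j≡last)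
        ... | tri> _ _ last<j = inj₁ (A.min<-after j last<j Gⱼ≢0)

      ⋆-before-first : ∀ r → r < A.first ℕ.+ B.first →
                       (G ⋆ H) r ≡ 0ℤ ⊎ A.min ℤ.+ B.min ℤ.< W ((G ⋆ H) r) r
      ⋆-before-first r r<r₀ =
        ⋆-above λ j j≤r Gⱼ≢0 Hᵣ₋ⱼ≢0 → strictlyAbove Gⱼ≢0 Hᵣ₋ⱼ≢0 (strict j j≤r Gⱼ≢0 Hᵣ₋ⱼ≢0)
        where
        strict : ∀ j → j ≤ r → G j ≢ 0ℤ → H (r ∸ j) ≢ 0ℤ → StrictlyAbove r j
        strict j j≤r Gⱼ≢0 Hᵣ₋ⱼ≢0 with j ℕ.<? A.first
        ... | yes j<first = inj₁ (A.min<-before j j<first Gⱼ≢0)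
        ... | no j≮first  = inj₂ (B.min<-before _ (∸-<-of-<-+ (ℕP.≮⇒≥ j≮first) j≤r r<r₀) Hᵣ₋ⱼ≢0)

      ⋆-after-last : ∀ r → A.last ℕ.+ B.last < r →
                     (G ⋆ H) r ≡ 0ℤ ⊎ A.min ℤ.+ B.min ℤ.< W ((G ⋆ H) r) r
      ⋆-after-last r r₁<r =
        ⋆-above λ j j≤r Gⱼ≢0 Hᵣ₋ⱼ≢0 → strictlyAbove Gⱼ≢0 Hᵣ₋ⱼ≢0 (strict j Gⱼ≢0 Hᵣ₋ⱼ≢0)
        where
        strict : ∀ j → G j ≢ 0ℤ → H (r ∸ j) ≢ 0ℤ → StrictlyAbove r j
        strict j Gⱼ≢0 Hᵣ₋ⱼ≢0 with A.last ℕ.<? j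
        ... | yes last<j = inj₁ (A.min<-after j last<j Gⱼ≢0)
        ... | no last≮j  = inj₂ (B.min<-after _ (<-∸-of-+-< (ℕP.≮⇒≥ last≮j) r₁<r) Hᵣ₋ⱼ≢0)

  -- The Newton polygon of F on [0, k] is the single edge joining its endpoints, of slope -s/k.
  record SingleEdge (F : ℕ → ℤ) : Set where
    field
      nonzero-0 : F 0 ≢ 0ℤ
      nonzero-k : F k ≢ 0ℤ
      endpoints : W (F 0) 0 ≡ W (F k) k
      onOrAbove : ∀ r → r ≤ k → F r ≢ 0ℤ → W (F 0) 0 ℤ.≤ W (F r) r

  W-0 : ∀ x → W x 0 ≡ + (k ℕ.* ν x)
  W-0 x = trans (cong (λ z → + (k ℕ.* ν x) ℤ.+ z) (ℤP.*-zeroʳ s)) (ℤP.+-identityʳ _)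

  SingleEdge-* : ∀ {F u c : ℕ → ℤ} {v} → (∀ r → r ≤ k → F r ≡ u r ℤ.* c r × u r ≢ 0ℤ × ν (u r) ≡ v) →
                 SingleEdge c → SingleEdge F
  SingleEdge-* {F} {u} {c} {v} F≡u*c edge = record
    { nonzero-0 = F≢0 z≤n c₀≢0
    ; nonzero-k = F≢0 ℕP.≤-refl cₖ≢0
    ; endpoints = begin
        W (F 0) 0                   ≡⟨ W-F z≤n c₀≢0 ⟩
        + (k ℕ.* v) ℤ.+ W (c 0) 0   ≡⟨ cong (λ z → + (k ℕ.* v) ℤ.+ z) (SingleEdge.endpoints edge) ⟩
        + (k ℕ.* v) ℤ.+ W (c k) k   ≡⟨ W-F ℕP.≤-refl cₖ≢0 ⟨
        W (F k) k                   ∎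
    ; onOrAbove = λ r r≤k Fᵣ≢0 → subst₂ ℤ._≤_ (sym (W-F z≤n c₀≢0)) (sym (W-F r≤k (cᵣ≢0 r≤k Fᵣ≢0)))
        (ℤP.+-monoʳ-≤ (+ (k ℕ.* v)) (SingleEdge.onOrAbove edge r r≤k (cᵣ≢0 r≤k Fᵣ≢0)))
    }
    where
    open ≡-Reasoning
    c₀≢0 : c 0 ≢ 0ℤ
    c₀≢0 = SingleEdge.nonzero-0 edge
    cₖ≢0 : c k ≢ 0ℤ
    cₖ≢0 = SingleEdge.nonzero-k edge
    F≢0 : ∀ {r} → r ≤ k → c r ≢ 0ℤ → F r ≢ 0ℤ
    F≢0 {r} r≤k cᵣ≢0 = subst (_≢ 0ℤ) (sym (proj₁ (F≡u*c r r≤k))) (*≢0 (proj₁ (proj₂ (F≡u*c r r≤k))) cᵣ≢0)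
    cᵣ≢0 : ∀ {r} → r ≤ k → F r ≢ 0ℤ → c r ≢ 0ℤ
    cᵣ≢0 {r} r≤k Fᵣ≢0 cᵣ≡0 =
      Fᵣ≢0 (trans (proj₁ (F≡u*c r r≤k)) (trans (cong (u r ℤ.*_) cᵣ≡0) (ℤP.*-zeroʳ (u r))))
    W-F : ∀ {r} → r ≤ k → c r ≢ 0ℤ → W (F r) r ≡ + (k ℕ.* v) ℤ.+ W (c r) r
    W-F {r} r≤k cᵣ≢0 with F≡u*c r r≤k
    ... | Fᵣ≡ , uᵣ≢0 , νuᵣ≡v = begin
      W (F r) r                  ≡⟨ cong (λ z → W z r) Fᵣ≡ ⟩
      W (u r ℤ.* c r) (0 ℕ.+ r)  ≡⟨ W-* 0 r uᵣ≢0 cᵣ≢0 ⟩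
      W (u r) 0 ℤ.+ W (c r) r    ≡⟨ cong (ℤ._+ W (c r) r) (W-0 (u r)) ⟩
      + (k ℕ.* ν (u r)) ℤ.+ W (c r) r
                                 ≡⟨ cong (λ z → + (k ℕ.* z) ℤ.+ W (c r) r) νuᵣ≡v ⟩
      + (k ℕ.* v) ℤ.+ W (c r) r  ∎

  W-0≡W⇒k∣∣s∣* : ∀ {x y d} → W x 0 ≡ W y d → k ∣ ∣ s ∣ ℕ.* d
  W-0≡W⇒k∣∣s∣* {x} {y} {d} Wx≡Wy = subst (k ∣_) (ℤP.abs-* s (+ d)) (ℤD.∣⇒∣ᵤ k∣s*d)
    where
    k∣s*d : + k ℤD.∣ s ℤ.* + d
    k∣s*d = ℤD.∣m+n∣m⇒∣n {+ k} {+ (k ℕ.* ν y)}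
      (subst (+ k ℤD.∣_) (trans (sym (W-0 x)) Wx≡Wy) (ℤD.∣ᵤ⇒∣ (ℕD.m∣m*n (ν x))))
      (ℤD.∣ᵤ⇒∣ (ℕD.m∣m*n (ν y)))

  -- The extreme terms of minimal weight of G ⋆ H sit at first_G + first_H and last_G + last_H; for a
  -- single edge they sit at 0 and k, which forces first_G = 0 and last_G = d.
  singleEdge-factor : ∀ {G H d e} → Degree G d → Degree H e → (∀ r → k < r → (G ⋆ H) r ≡ 0ℤ) →
                      SingleEdge (G ⋆ H) → W (G 0) 0 ≡ W (G d) d
  singleEdge-factor {G} {H} {d} {e} deg-G deg-H ⋆-vanishes edge =
    trans (subst (λ i → W (G i) i ≡ A.min) first≡0 A.w-first)
          (sym (subst (λ i → W (G i) i ≡ A.min) last≡d A.w-last))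
    where
    A : MinimalWeight (λ i → W (G i) i) (λ i → G i ≢ 0ℤ)
    A = minimalWeight (λ i → W (G i) i) (≢0? G) d (λ j → ≢0⇒≤bound (proj₂ deg-G)) (proj₁ deg-G)
    B : MinimalWeight (λ i → W (H i) i) (λ i → H i ≢ 0ℤ)
    B = minimalWeight (λ i → W (H i) i) (≢0? H) e (λ j → ≢0⇒≤bound (proj₂ deg-H)) (proj₁ deg-H)
    module A = MinimalWeight A
    module B = MinimalWeight B
    W⋆₀≤ : ∀ {r} → (G ⋆ H) r ≢ 0ℤ × W ((G ⋆ H) r) r ≡ A.min ℤ.+ B.min → W ((G ⋆ H) 0) 0 ℤ.≤ A.min ℤ.+ B.min
    W⋆₀≤ (⋆ᵣ≢0 , W⋆ᵣ≡) = subst (W ((G ⋆ H) 0) 0 ℤ.≤_) W⋆ᵣ≡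
      (SingleEdge.onOrAbove edge _ (≢0⇒≤bound ⋆-vanishes ⋆ᵣ≢0) ⋆ᵣ≢0)
    r₀≡0 : A.first ℕ.+ B.first ≡ 0
    r₀≡0 = ℕP.n≤0⇒n≡0 (ℕP.≮⇒≥ λ 0<r₀ →
      [ SingleEdge.nonzero-0 edge , (λ M<W⋆₀ → ℤP.<⇒≱ M<W⋆₀ (W⋆₀≤ (⋆-first G H A B))) ]′
      (⋆-before-first G H A B 0 0<r₀))
    r₁≡k : A.last ℕ.+ B.last ≡ k
    r₁≡k = ℕP.≤-antisym (≢0⇒≤bound ⋆-vanishes (proj₁ (⋆-last G H A B))) (ℕP.≮⇒≥ λ r₁<k →
      [ SingleEdge.nonzero-k edge ,
        (λ M<W⋆ₖ → ℤP.<⇒≱ M<W⋆ₖ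
          (subst (ℤ._≤ A.min ℤ.+ B.min) (SingleEdge.endpoints edge) (W⋆₀≤ (⋆-last G H A B)))) ]′
      (⋆-after-last G H A B k r₁<k))
    first≡0 : A.first ≡ 0
    first≡0 = ℕP.m+n≡0⇒m≡0 A.first r₀≡0
    last≡d : A.last ≡ d
    last≡d = ℕP.≤-antisym (≢0⇒≤bound (proj₂ deg-G) A.P-last) (ℕP.≮⇒≥ λ last<d → ℕP.<⇒≱
      (ℕP.+-mono-<-≤ last<d (≢0⇒≤bound (proj₂ deg-H) B.P-last))
      (subst (d ℕ.+ e ≤_) (sym r₁≡k) (≢0⇒≤bound ⋆-vanishes (⋆-leading G H deg-G deg-H))))

  factorDegree : ∀ {f g h d} {φ : ℕ → ℤ} →
                 (∀ r → r ≤ k → coeff f r ≡ toℚ (φ r)) → (∀ r → k < r → coeff f r ≡ 0ℚ) → SingleEdge φ →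
                 (g *ₚ h) ≈ₚ f → HasDegree g d → k ∣ ∣ s ∣ ℕ.* d
  factorDegree {f} {g} {h} {d} {φ} f≡φ f-vanishes edge-φ gh≈f (g_d≢0 , g-vanishes)
    with clearDenominators g | clearDenominators h
  ... | Dg , G , Dg≢0 , G≡Dg*g | Dh , H , Dh≢0 , H≡Dh*h =
    W-0≡W⇒k∣∣s∣* {G 0} {G d} (singleEdge-factor deg-G (proj₂ deg-H) ⋆-vanishes edge-⋆)
    where
    ⋆≡ : ∀ {r x} → coeff f r ≡ toℚ x → (G ⋆ H) r ≡ (Dg ℤ.* Dh) ℤ.* x
    ⋆≡ = ⋆-clearDenominators {f} {g} {h} {Dg} {Dh} {G} {H} gh≈f G≡Dg*g H≡Dh*h
    ⋆-vanishes : ∀ r → k < r → (G ⋆ H) r ≡ 0ℤ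
    ⋆-vanishes r k<r = trans (⋆≡ (f-vanishes r k<r)) (ℤP.*-zeroʳ (Dg ℤ.* Dh))
    edge-⋆ : SingleEdge (G ⋆ H)
    edge-⋆ = SingleEdge-* {G ⋆ H} {λ _ → Dg ℤ.* Dh} {φ}
      (λ r r≤k → ⋆≡ (f≡φ r r≤k) , *≢0 Dg≢0 Dh≢0 , refl) edge-φ
    deg-G : Degree G d
    deg-G = Clears-≢0 {Dg} {g} {G} Dg≢0 G≡Dg*g g_d≢0 ,
            λ i d<i → Clears-≡0 {Dg} {g} {G} G≡Dg*g (g-vanishes i d<i)
    H₀≢0 : H 0 ≢ 0ℤ
    H₀≢0 H₀≡0 = SingleEdge.nonzero-0 edge-⋆ (trans (cong (G 0 ℤ.*_) H₀≡0) (ℤP.*-zeroʳ (G 0)))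
    deg-H : ∃ (Degree H)
    deg-H = degree-exists (λ i len<i → Clears-≡0 {Dh} {h} {H} H≡Dh*h (coeff-≥length h i (ℕP.<⇒≤ len<i)))
                          H₀≢0

C*!≡P′ : ∀ {m j} → j ≤ m → (m C j) ℕ.* j ! ≡ m P′ j
C*!≡P′ {m} {j} j≤m = begin
  (m C j) ℕ.* j !           ≡⟨ cong (ℕ._* j !) (nCk≡nPk/k! j≤m) ⟩
  (m P j) / j ! ℕ.* j !     ≡⟨ cong (λ z → z / j ! ℕ.* j !)
                                    (trans (nPk≡n!/[n∸k]! j≤m) (sym (nP′k≡n!/[n∸k]! j≤m))) ⟩
  (m P′ j) / j ! ℕ.* j !    ≡⟨ m/n*n≡m (k!∣nP′k j≤m) ⟩
  m P′ j                    ∎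
  where
  open ≡-Reasoning
  instance _ = j ℕP.!≢0

P′≢0 : ∀ {m j} → j ≤ m → m P′ j ≢ 0
P′≢0 {m} {suc j} 1+j≤m mPj≡0 with ℕP.m*n≡0⇒m≡0∨n≡0 (m ∸ j) mPj≡0
... | inj₁ m∸j≡0  = ℕP.<⇒≱ 1+j≤m (ℕP.m∸n≡0⇒m≤n m∸j≡0)
... | inj₂ mP′j≡0 = P′≢0 (ℕP.<⇒≤ 1+j≤m) mP′j≡0

C≢0 : ∀ {m j} → j ≤ m → m C j ≢ 0
C≢0 {m} {j} j≤m mCj≡0 = P′≢0 j≤m (trans (sym (C*!≡P′ j≤m)) (cong (ℕ._* j !) mCj≡0))

module BinomialValuation (p : ℕ) (p-prime : Prime p) where

  open Valuation p p-prime

  0<t<p⇒p∤t : ∀ {t} → 0 < t → t < p → ¬ p ∣ t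
  0<t<p⇒p∤t {t} 0<t t<p p∣t = ℕP.<⇒≱ t<p (ℕD.∣⇒≤ {{ℕ.>-nonZero 0<t}} p∣t)

  p∤! : ∀ {j} → j < p → ¬ p ∣ j !
  p∤! {zero}  _     = p∤1
  p∤! {suc j} 1+j<p p∣[1+j]! with euclidsLemma (suc j) (j !) p-prime p∣[1+j]!
  ... | inj₁ p∣1+j = 0<t<p⇒p∤t (s≤s z≤n) 1+j<p p∣1+j
  ... | inj₂ p∣j!  = p∤! (ℕP.<⇒≤ 1+j<p) p∣j!

  valEq-*-unit : ∀ {x u v} → ¬ p ∣ u → ValEq p x v → ValEq p (x ℕ.* u) v
  valEq-*-unit {x} {u} {v} p∤u vx =
    subst (ValEq p (x ℕ.* u)) (ℕP.+-identityʳ v) (valEq-* {x} {u} {v} {0} vx (valEq-0 p∤u))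

  -- j! is prime to p for j < p, so C(m, j) and m P′ j = C(m, j) · j! have the same valuation.
  module _ {m j} (j≤m : j ≤ m) (j<p : j < p) where

    private
      νC : ℕ
      νC = proj₁ (valEq-exists (m C j) (C≢0 j≤m))
      valEq-νC : ValEq p (m C j) νC
      valEq-νC = proj₂ (valEq-exists (m C j) (C≢0 j≤m))
      valEq-P′ : ValEq p (m P′ j) νC
      valEq-P′ = subst (λ z → ValEq p z νC) (C*!≡P′ j≤m) (valEq-*-unit {m C j} {j !} {νC} (p∤! j<p) valEq-νC)

    valEq-C : ∀ {v} → ValEq p (m P′ j) v → ValEq p (m C j) v
    valEq-C {v} vP′ = subst (ValEq p (m C j)) (valEq-unique {m P′ j} {νC} {v} valEq-P′ vP′) valEq-νC

    p^∣C : ∀ {e} → p ^ e ∣ m P′ j → p ^ e ∣ m C j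
    p^∣C {e} p^e∣P′ = ≤valEq⇒p^∣ {m C j} {e} {νC} (p^∣⇒≤valEq {m P′ j} {e} {νC} p^e∣P′ valEq-P′) valEq-νC

  valEq-P′-units : ∀ m j → (∀ i → i < j → ¬ p ∣ m ∸ i) → ValEq p (m P′ j) 0
  valEq-P′-units m zero    _     = valEq-0 p∤1
  valEq-P′-units m (suc j) units = valEq-* {m ∸ j} {m P′ j} {0} {0} (valEq-0 (units j ℕP.≤-refl))
    (valEq-P′-units m j (λ i i<j → units i (ℕP.m≤n⇒m≤1+n i<j)))

  valEq-P′-single : ∀ m j {i₀ e} → i₀ < j → ValEq p (m ∸ i₀) e → (∀ i → i < j → i ≢ i₀ → ¬ p ∣ m ∸ i) →
                    ValEq p (m P′ j) e
  valEq-P′-single m (suc j) {i₀} {e} i₀<1+j v units with j ℕ.≟ i₀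
  ... | yes refl = subst (ValEq p (m P′ suc j)) (ℕP.+-identityʳ e) (valEq-* {m ∸ j} {m P′ j} {e} {0} v
    (valEq-P′-units m j (λ i i<j → units i (ℕP.m≤n⇒m≤1+n i<j) (λ { refl → ℕP.<-irrefl refl i<j }))))
  ... | no j≢i₀ = valEq-* {m ∸ j} {m P′ j} {0} {e} (valEq-0 (units j ℕP.≤-refl j≢i₀))
    (valEq-P′-single m j {e = e} (ℕP.≤∧≢⇒< (ℕP.≤-pred i₀<1+j) (j≢i₀ ∘ sym)) v
                     (λ i i<j → units i (ℕP.m≤n⇒m≤1+n i<j)))

  p^∣P′ : ∀ m j {i₀ e} → i₀ < j → p ^ e ∣ m ∸ i₀ → p ^ e ∣ m P′ j
  p^∣P′ m (suc j) {i₀} {e} i₀<1+j p^e∣m∸i₀ with j ℕ.≟ i₀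
  ... | yes refl = ℕD.∣m⇒∣m*n (m P′ j) p^e∣m∸i₀
  ... | no j≢i₀  =
    ℕD.∣n⇒∣m*n (m ∸ j) (p^∣P′ m j {e = e} (ℕP.≤∧≢⇒< (ℕP.≤-pred i₀<1+j) (j≢i₀ ∘ sym)) p^e∣m∸i₀)

∣signPow∣≡1 : ∀ m → ∣ signPow m ∣ ≡ 1
∣signPow∣≡1 zero    = refl
∣signPow∣≡1 (suc m) = trans (ℤP.∣-i∣≡∣i∣ (signPow m)) (∣signPow∣≡1 m)

∣cCoef∣ : ∀ n k j → ∣ cCoef n k j ∣ ≡ (n C j) ℕ.* ((n ∸ j ∸ 1) C (k ∸ j))
∣cCoef∣ n k j = trans (ℤP.abs-* (+ ((n C j) ℕ.* ((n ∸ j ∸ 1) C (k ∸ j)))) (signPow (k ∸ j)))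
                      (trans (cong ((n C j) ℕ.* ((n ∸ j ∸ 1) C (k ∸ j)) ℕ.*_) (∣signPow∣≡1 (k ∸ j)))
                             (ℕP.*-identityʳ _))

k∸j≤n∸j∸1 : ∀ {n k j} → k < n → k ∸ j ≤ n ∸ j ∸ 1
k∸j≤n∸j∸1 {n} {k} {j} k<n =
  subst (k ∸ j ≤_) (trans (cong (n ∸_) (ℕP.+-comm 1 j)) (sym (ℕP.∸-+-assoc n j 1))) (ℕP.∸-monoˡ-≤ (suc j) k<n)

cCoef≢0 : ∀ {n k j} → k < n → j ≤ k → cCoef n k j ≢ 0ℤ
cCoef≢0 {n} {k} {j} k<n j≤k cⱼ≡0 with ℕP.m*n≡0⇒m≡0∨n≡0 (n C j) (trans (sym (∣cCoef∣ n k j)) (cong ∣_∣ cⱼ≡0))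
... | inj₁ nCj≡0 = C≢0 (ℕP.≤-trans j≤k (ℕP.<⇒≤ k<n)) nCj≡0
... | inj₂ C≡0   = C≢0 (k∸j≤n∸j∸1 {j = j} k<n) C≡0

n∸t≡[n∸k]+[k∸t] : ∀ {n k t} → k ≤ n → t ≤ k → n ∸ t ≡ (n ∸ k) ℕ.+ (k ∸ t)
n∸t≡[n∸k]+[k∸t] {n} {k} {t} k≤n t≤k = trans (cong (_∸ t) (sym (ℕP.m∸n+n≡m k≤n))) (ℕP.+-∸-assoc (n ∸ k) t≤k)

module CoefficientValuation (p : ℕ) (p-prime : Prime p) {n k e : ℕ}
                            (0<k : 0 < k) (k<n : k < n) (k<p : k < p) (0<e : 0 < e) where

  open Valuation p p-prime
  open BinomialValuation p p-prime

  private
    k≤n : k ≤ n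
    k≤n = ℕP.<⇒≤ k<n

    p∤gap : ∀ {x t} → 0 < t → t ≤ k → p ∣ x → ¬ p ∣ x ℕ.+ t
    p∤gap 0<t t≤k p∣x p∣x+t = 0<t<p⇒p∤t 0<t (ℕP.≤-<-trans t≤k k<p) (ℕD.∣m+n∣m⇒∣n p∣x+t p∣x)

    valEq-C0 : ∀ m → ValEq p (m C 0) 0
    valEq-C0 m = valEq-C {m} {0} z≤n (ℕP.≤-<-trans z≤n k<p) {0} (valEq-P′-units m 0 λ _ ())

    ∣cₖ∣ : ∣ cCoef n k k ∣ ≡ (n C k) ℕ.* ((n ∸ k ∸ 1) C 0)
    ∣cₖ∣ = trans (∣cCoef∣ n k k) (cong (λ z → (n C k) ℕ.* ((n ∸ k ∸ 1) C z)) (ℕP.n∸n≡0 k))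

    p∣⇐valEq : ∀ {x} → ValEq p x e → p ∣ x
    p∣⇐valEq (p^e∣x , _) = ℕD.∣-trans (subst (_∣ p ^ e) (ℕP.*-identityʳ p) (^-monoʳ-∣ p 0<e)) p^e∣x

  -- Of the integers n - k, …, n only n is divisible by p, as k < p.
  module ValuationOfN (vn : ValEq p n e) where

    private
      n∸t-unit : ∀ t → 0 < t → t ≤ k → ¬ p ∣ n ∸ t
      n∸t-unit t 0<t t≤k p∣n∸t =
        p∤gap 0<t t≤k p∣n∸t (subst (p ∣_) (sym (ℕP.m∸n+n≡m (ℕP.≤-trans t≤k k≤n))) (p∣⇐valEq vn))

      valEq-nCj : ∀ j → 0 < j → j ≤ k → ValEq p (n C j) e
      valEq-nCj j 0<j j≤k = valEq-C {n} {j} (ℕP.≤-trans j≤k k≤n) (ℕP.≤-<-trans j≤k k<p) {e}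
        (valEq-P′-single n j {0} {e} 0<j vn
          λ i i<j i≢0 → n∸t-unit i (ℕP.n≢0⇒n>0 i≢0) (ℕP.≤-trans (ℕP.<⇒≤ i<j) j≤k))

    valEq-c₀ : ValEq p ∣ cCoef n k 0 ∣ 0
    valEq-c₀ = subst (λ z → ValEq p z 0) (sym (∣cCoef∣ n k 0))
      (valEq-* {n C 0} {(n ∸ 1) C k} {0} {0} (valEq-C0 n)
        (valEq-C {n ∸ 1} {k} (k∸j≤n∸j∸1 {j = 0} k<n) k<p {0} (valEq-P′-units (n ∸ 1) k λ i i<k →
          subst (λ z → ¬ p ∣ z) (sym (ℕP.∸-+-assoc n 1 i)) (n∸t-unit (suc i) (s≤s z≤n) i<k))))

    valEq-cₖ : ValEq p ∣ cCoef n k k ∣ e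
    valEq-cₖ = subst₂ (ValEq p) (sym ∣cₖ∣) (ℕP.+-identityʳ e)
      (valEq-* {n C k} {(n ∸ k ∸ 1) C 0} {e} {0} (valEq-nCj k 0<k ℕP.≤-refl) (valEq-C0 (n ∸ k ∸ 1)))

    p^e∣cⱼ : ∀ j → 0 < j → j ≤ k → p ^ e ∣ ∣ cCoef n k j ∣
    p^e∣cⱼ j 0<j j≤k = subst (p ^ e ∣_) (sym (∣cCoef∣ n k j)) (ℕD.∣m⇒∣m*n _ (proj₁ (valEq-nCj j 0<j j≤k)))

  -- Of the integers n - k, …, n only n - k is divisible by p, as k < p.
  module ValuationOfN∸K (vm : ValEq p (n ∸ k) e) where

    private
      n∸t-unit : ∀ t → t < k → ¬ p ∣ n ∸ t
      n∸t-unit t t<k p∣n∸t = p∤gap (ℕP.m<n⇒0<n∸m t<k) (ℕP.m∸n≤m k t) (p∣⇐valEq vm)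
        (subst (p ∣_) (n∸t≡[n∸k]+[k∸t] k≤n (ℕP.<⇒≤ t<k)) p∣n∸t)

      factor≡ : ∀ j i → n ∸ j ∸ 1 ∸ i ≡ n ∸ (j ℕ.+ suc i)
      factor≡ j i = trans (ℕP.∸-+-assoc (n ∸ j) 1 i) (ℕP.∸-+-assoc n j (suc i))

      last-factor≡n∸k : ∀ {j} → j < k → n ∸ j ∸ 1 ∸ (k ∸ j ∸ 1) ≡ n ∸ k
      last-factor≡n∸k {j} j<k = trans (factor≡ j (k ∸ j ∸ 1)) (cong (n ∸_)
        (trans (cong (j ℕ.+_) (ℕP.m+[n∸m]≡n (ℕP.m<n⇒0<n∸m j<k))) (ℕP.m+[n∸m]≡n (ℕP.<⇒≤ j<k))))

      k∸j∸1<k∸j : ∀ {j} → j < k → k ∸ j ∸ 1 < k ∸ j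
      k∸j∸1<k∸j j<k = ℕP.∸-monoʳ-< {o = 0} (s≤s z≤n) (ℕP.m<n⇒0<n∸m j<k)

    valEq-c₀ : ValEq p ∣ cCoef n k 0 ∣ e
    valEq-c₀ = subst (λ z → ValEq p z e) (sym (∣cCoef∣ n k 0))
      (valEq-* {n C 0} {(n ∸ 1) C k} {0} {e} (valEq-C0 n)
        (valEq-C {n ∸ 1} {k} (k∸j≤n∸j∸1 {j = 0} k<n) k<p {e}
          (valEq-P′-single (n ∸ 1) k {k ∸ 1} {e} (k∸j∸1<k∸j 0<k)
            (subst (λ z → ValEq p z e) (sym (last-factor≡n∸k 0<k)) vm)
            λ i i<k i≢k∸1 → subst (λ z → ¬ p ∣ z) (sym (factor≡ 0 i))
                              (n∸t-unit (suc i) (ℕP.≤∧≢⇒< i<k λ { refl → i≢k∸1 refl })))))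

    valEq-cₖ : ValEq p ∣ cCoef n k k ∣ 0
    valEq-cₖ = subst (λ z → ValEq p z 0) (sym ∣cₖ∣) (valEq-* {n C k} {(n ∸ k ∸ 1) C 0} {0} {0}
      (valEq-C {n} {k} k≤n k<p {0} (valEq-P′-units n k n∸t-unit)) (valEq-C0 (n ∸ k ∸ 1)))

    p^e∣cⱼ : ∀ j → j < k → p ^ e ∣ ∣ cCoef n k j ∣
    p^e∣cⱼ j j<k = subst (p ^ e ∣_) (sym (∣cCoef∣ n k j)) (ℕD.∣n⇒∣m*n (n C j)
      (p^∣C {n ∸ j ∸ 1} {k ∸ j} (k∸j≤n∸j∸1 {j = j} k<n) (ℕP.≤-<-trans (ℕP.m∸n≤m k j) k<p) {e}
        (p^∣P′ (n ∸ j ∸ 1) (k ∸ j) {e = e} (k∸j∸1<k∸j j<k)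
          (subst (p ^ e ∣_) (sym (last-factor≡n∸k j<k)) (proj₁ vm)))))

module SingleEdgeOfCCoef (p : ℕ) (p-prime : Prime p) {n k e : ℕ}
                         (0<k : 0 < k) (k<n : k < n) (k<p : k < p) (0<e : 0 < e) where

  open CoefficientValuation p p-prime 0<k k<n k<p 0<e
  open Valuation p p-prime using (ν; ν-unique; ∣ᶻ⇒≤ν)

  private
    c : ℕ → ℤ
    c = cCoef n k

    cᵣ≢0 : ∀ {r} → r ≤ k → c r ≢ 0ℤ
    cᵣ≢0 = cCoef≢0 k<n

    e≤νcᵣ : ∀ {r} → r ≤ k → p ^ e ∣ ∣ c r ∣ → e ≤ ν (c r)
    e≤νcᵣ r≤k p^e∣cᵣ = ∣ᶻ⇒≤ν (cᵣ≢0 r≤k) (ℤD.∣ᵤ⇒∣ p^e∣cᵣ)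

  module _ (vn : ValEq p n e) where

    open ValuationOfN vn
    open Weight p p-prime k (ℤ.- + e) using (W; SingleEdge)
    open ≡-Reasoning

    private
      W≡⊖ : ∀ x r → W x r ≡ k ℕ.* ν x ⊖ e ℕ.* r
      W≡⊖ x r = begin
        + (k ℕ.* ν x) ℤ.+ ℤ.- + e ℤ.* + r     ≡⟨ cong (λ z → + (k ℕ.* ν x) ℤ.+ z)
                                                       (ℤP.neg-distribˡ-* (+ e) (+ r)) ⟨
        + (k ℕ.* ν x) ℤ.+ ℤ.- (+ e ℤ.* + r)   ≡⟨ cong (λ z → + (k ℕ.* ν x) ℤ.+ ℤ.- z) (ℤP.pos-* e r) ⟨
        + (k ℕ.* ν x) ℤ.+ ℤ.- + (e ℕ.* r)     ≡⟨ ℤP.m-n≡m⊖n (k ℕ.* ν x) (e ℕ.* r) ⟩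
        k ℕ.* ν x ⊖ e ℕ.* r                   ∎

      Wc₀≡0 : W (c 0) 0 ≡ 0ℤ
      Wc₀≡0 = begin
        W (c 0) 0                  ≡⟨ W≡⊖ (c 0) 0 ⟩
        k ℕ.* ν (c 0) ⊖ e ℕ.* 0    ≡⟨ cong₂ _⊖_ (cong (k ℕ.*_) (ν-unique {c 0} valEq-c₀)) (ℕP.*-zeroʳ e) ⟩
        k ℕ.* 0 ⊖ 0                ≡⟨ cong (_⊖ 0) (ℕP.*-zeroʳ k) ⟩
        0ℤ                         ∎

      Wcₖ≡0 : W (c k) k ≡ 0ℤ
      Wcₖ≡0 = begin
        W (c k) k                  ≡⟨ W≡⊖ (c k) k ⟩
        k ℕ.* ν (c k) ⊖ e ℕ.* k    ≡⟨ cong (_⊖ e ℕ.* k) (cong (k ℕ.*_) (ν-unique {c k} valEq-cₖ)) ⟩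
        k ℕ.* e ⊖ e ℕ.* k          ≡⟨ cong (_⊖ e ℕ.* k) (ℕP.*-comm k e) ⟩
        e ℕ.* k ⊖ e ℕ.* k          ≡⟨ ℤP.n⊖n≡0 (e ℕ.* k) ⟩
        0ℤ                         ∎

      0≤Wcᵣ : ∀ r → 0 < r → r ≤ k → 0ℤ ℤ.≤ W (c r) r
      0≤Wcᵣ r 0<r r≤k = subst (0ℤ ℤ.≤_) (sym (trans (W≡⊖ (c r) r) (ℤP.⊖-≥ er≤kνcᵣ))) (ℤ.+≤+ z≤n)
        where
        er≤kνcᵣ : e ℕ.* r ≤ k ℕ.* ν (c r)
        er≤kνcᵣ = ℕP.≤-trans (ℕP.*-monoʳ-≤ e r≤k) (subst (_≤ k ℕ.* ν (c r)) (ℕP.*-comm k e)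
                    (ℕP.*-monoʳ-≤ k (e≤νcᵣ r≤k (p^e∣cⱼ r 0<r r≤k))))

    singleEdge-cCoef-n : SingleEdge c
    singleEdge-cCoef-n = record
      { nonzero-0 = cᵣ≢0 z≤n
      ; nonzero-k = cᵣ≢0 ℕP.≤-refl
      ; endpoints = trans Wc₀≡0 (sym Wcₖ≡0)
      ; onOrAbove = onOrAbove
      }
      where
      onOrAbove : ∀ r → r ≤ k → c r ≢ 0ℤ → W (c 0) 0 ℤ.≤ W (c r) r
      onOrAbove zero    _   _ = ℤP.≤-refl
      onOrAbove (suc r) r≤k _ =
        subst (ℤ._≤ W (c (suc r)) (suc r)) (sym Wc₀≡0) (0≤Wcᵣ (suc r) (s≤s z≤n) r≤k)

  module _ (vm : ValEq p (n ∸ k) e) where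

    open ValuationOfN∸K vm
    open Weight p p-prime k (+ e) using (W; SingleEdge)
    open ≡-Reasoning

    private
      W≡+ : ∀ x r → W x r ≡ + (k ℕ.* ν x ℕ.+ e ℕ.* r)
      W≡+ x r = begin
        + (k ℕ.* ν x) ℤ.+ + e ℤ.* + r       ≡⟨ cong (λ z → + (k ℕ.* ν x) ℤ.+ z) (ℤP.pos-* e r) ⟨
        + (k ℕ.* ν x) ℤ.+ + (e ℕ.* r)       ≡⟨ ℤP.pos-+ (k ℕ.* ν x) (e ℕ.* r) ⟨
        + (k ℕ.* ν x ℕ.+ e ℕ.* r)           ∎

      Wc₀≡ke : W (c 0) 0 ≡ + (k ℕ.* e)
      Wc₀≡ke = begin
        W (c 0) 0                           ≡⟨ W≡+ (c 0) 0 ⟩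
        + (k ℕ.* ν (c 0) ℕ.+ e ℕ.* 0)       ≡⟨ cong₂ (λ u v → + (k ℕ.* u ℕ.+ v))
                                                      (ν-unique {c 0} valEq-c₀) (ℕP.*-zeroʳ e) ⟩
        + (k ℕ.* e ℕ.+ 0)                   ≡⟨ cong +_ (ℕP.+-identityʳ (k ℕ.* e)) ⟩
        + (k ℕ.* e)                         ∎

      Wcₖ≡ke : W (c k) k ≡ + (k ℕ.* e)
      Wcₖ≡ke = begin
        W (c k) k                           ≡⟨ W≡+ (c k) k ⟩
        + (k ℕ.* ν (c k) ℕ.+ e ℕ.* k)       ≡⟨ cong (λ u → + (k ℕ.* u ℕ.+ e ℕ.* k))
                                                    (ν-unique {c k} valEq-cₖ) ⟩
        + (k ℕ.* 0 ℕ.+ e ℕ.* k)             ≡⟨ cong (λ u → + (u ℕ.+ e ℕ.* k)) (ℕP.*-zeroʳ k) ⟩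
        + (e ℕ.* k)                         ≡⟨ cong +_ (ℕP.*-comm e k) ⟩
        + (k ℕ.* e)                         ∎

      ke≤Wcᵣ : ∀ r → r < k → + (k ℕ.* e) ℤ.≤ W (c r) r
      ke≤Wcᵣ r r<k = subst (+ (k ℕ.* e) ℤ.≤_) (sym (W≡+ (c r) r)) (ℤ.+≤+ (ℕP.≤-trans
        (ℕP.*-monoʳ-≤ k (e≤νcᵣ (ℕP.<⇒≤ r<k) (p^e∣cⱼ r r<k))) (ℕP.m≤m+n (k ℕ.* ν (c r)) (e ℕ.* r))))

    singleEdge-cCoef-n∸k : SingleEdge c
    singleEdge-cCoef-n∸k = record
      { nonzero-0 = cᵣ≢0 z≤n
      ; nonzero-k = cᵣ≢0 ℕP.≤-refl
      ; endpoints = trans Wc₀≡ke (sym Wcₖ≡ke)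
      ; onOrAbove = λ r r≤k _ → subst (ℤ._≤ W (c r) r) (sym Wc₀≡ke) (ke≤W r r≤k)
      }
      where
      ke≤W : ∀ r → r ≤ k → + (k ℕ.* e) ℤ.≤ W (c r) r
      ke≤W r r≤k with ℕP.m≤n⇒m<n∨m≡n r≤k
      ... | inj₁ r<k  = ke≤Wcᵣ r r<k
      ... | inj₂ refl = ℤP.≤-reflexive (sym Wcₖ≡ke)

  -- ν_p(n) = e puts the edge from (0, 0) to (k, e); ν_p(n - k) = e from (0, e) to (k, 0).
  singleEdge-cCoef : ValEq p n e ⊎ ValEq p (n ∸ k) e →
                     ∃ λ s → ∣ s ∣ ≡ e × Weight.SingleEdge p p-prime k s (cCoef n k)
  singleEdge-cCoef (inj₁ vn) = ℤ.- + e , ℤP.∣-i∣≡∣i∣ (+ e) , singleEdge-cCoef-n vn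
  singleEdge-cCoef (inj₂ vm) = + e , refl , singleEdge-cCoef-n∸k vm

kOverGcd-∣ : ∀ {k e d} → 0 < k → k ∣ e ℕ.* d → kOverGcd k e ∣ d
kOverGcd-∣ {k} {e} {d} 0<k k∣e*d = coprime-divisor k′⊥e′ (ℕD.*-cancelʳ-∣ g k′*g∣e′*d*g)
  where
  g : ℕ
  g = gcd k e
  instance
    g≢0 : ℕ.NonZero g
    g≢0 = ℕ.≢-nonZero (gcd[m,n]≢0 k e (inj₁ (ℕ.≢-nonZero⁻¹ k {{ℕ.>-nonZero 0<k}})))
  k′ e′ : ℕ
  k′ = kOverGcd k e
  e′ = ℕD.quotient (gcd[m,n]∣n k e)
  k′⊥e′ : Coprime k′ e′
  k′⊥e′ = subst₂ Coprime (ℕD.n/m≡quotient (gcd[m,n]∣m k e)) (ℕD.n/m≡quotient (gcd[m,n]∣n k e))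
                         (coprime-/gcd k e)
  k′*g∣e′*d*g : k′ ℕ.* g ∣ e′ ℕ.* d ℕ.* g
  k′*g∣e′*d*g = subst₂ _∣_ (ℕD._∣_.equality (gcd[m,n]∣m k e))
    (trans (cong (ℕ._* d) (ℕD._∣_.equality (gcd[m,n]∣n k e))) (ℕ*.xy∙z≈xz∙y e′ g d)) k∣e*d


lemma1 : (n k : ℕ) → 1 ≤ k → k < n →
         (a : ℕ → ℤ) →
         (∀ j → j ≤ k → a j ≢ 0ℤ) →
         (∀ j → j ≤ k → ∀ q → Prime q → q ∣ (∣ a j ∣) → q ≤ k) →
         (p e : ℕ) → Prime p → k < p → 1 ≤ e →
         (ValEq p n e ⊎ ValEq p (n ∸ k) e) →
         ∀ g → Irreducible g → g ∣ₚ fPoly n k a →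
         ∀ d → HasDegree g d → kOverGcd k e ∣ d
lemma1 n k 0<k k<n a a≢0 a-smooth p e p-prime k<p 0<e valuation g _ (h , gh≈f) d deg-g
  with SingleEdgeOfCCoef.singleEdge-cCoef p p-prime 0<k k<n k<p 0<e valuation
... | s , ∣s∣≡e , edge-c =
  kOverGcd-∣ 0<k (subst (λ z → k ∣ z ℕ.* d) ∣s∣≡e (factorDegree {fPoly n k a} {g} {h} {d}
    (λ r r≤k → coeff-map-applyUpTo-< _ id r (s≤s r≤k)) (λ r k<r → coeff-map-applyUpTo-≥ _ id r k<r)
    edge-a*c gh≈f deg-g))
  where
  open Weight p p-prime k s
  νa≡0 : ∀ r → r ≤ k → ν (a r) ≡ 0
  νa≡0 r r≤k = ν-unique {a r} (valEq-0 λ p∣aᵣ → ℕP.<⇒≱ k<p (a-smooth r r≤k p p-prime p∣aᵣ))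
  edge-a*c : SingleEdge (λ r → a r ℤ.* cCoef n k r)
  edge-a*c = SingleEdge-* (λ r r≤k → refl , a≢0 r r≤k , νa≡0 r r≤k) edge-c
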